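{- Let $\mathcal{A}_{\mathbf S}$ be a deformation of the braid arrangement in $\mathbb{R}^n$, $T\in\mathcal{T}^{(m)}(n)$, and let $X=(v_1,\dots,v_k)$ be an $\mathbf S$-connected cadet sequence of $T$ whose maximal $\mathbf S$-cadet sequences are $X_1,\dots,X_{k'}$, in increasing order of the index of their last node. If $r_{\mathbf S}(X)\ne0$ and $k'>1$, then $|X_1\setminus X_2|=1=|X_{k'}\setminus X_{k'-1}|$.
   Context: A deformation of the braid arrangement in $\mathbb{R}^n$ is a finite set $\mathcal{A}$ of hyperplanes $x_i-x_j=s$ ($1\le i<j\le n$, $s\in\mathbb{Z}$), encoded by $\mathbf S=(S_{i,j})_{i<j}$, $S_{i,j}=\{s:(x_i-x_j=s)\in\mathcal{A}\}$. For $i<j$: $S^-_{i,j}:=\{s\ge0:-s\in S_{i,j}\}$, $S^-_{j,i}:=\{0\}\cup\{s>0:s\in S_{i,j}\}$. $m=\max\{|s|:s\in\bigcup S_{i,j}\}$. $\mathcal{T}^{(m)}(n)$: rooted plane trees whose vertices are nodes (exactly $m+1$ ordered children) or leaves, with $n$ nodes labeled bijectively by $1,\dots,n$. $\mathsf{cadet}(u)$: rightmost child of node $u$ that is a node, if any. $\mathsf{lsib}(v)$: number of children of the parent of $v$ to the left of $v$. A cadet sequence is a sequence of nodes $(v_1,\dots,v_k)$ with $v_p=\mathsf{cadet}(v_{p-1})$; it is an $\mathbf S$-cadet sequence if $\sum_{p=i+1}^{j}\mathsf{lsib}(v_p)\notin S^-_{v_i,v_j}$ for all $i<j$. A cadet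 sequence $(v_1,\dots,v_k)$ is maximal if $v_k$ has no cadet and $v_1$ is not the cadet of any node. An $\mathbf S$-cadet sequence $(v_i,\dots,v_j)$ inside the maximal cadet sequence $(v_1,\dots,v_k)$ is a maximal $\mathbf S$-cadet sequence if (a) $i=1$ or $(v_{i-1},\dots,v_j)$ is not $\mathbf S$-cadet, and (b) $j=k$ or $(v_i,\dots,v_{j+1})$ is not $\mathbf S$-cadet. Cadet sequences are identified with their node sets. A nonempty cadet sequence $X$ is $\mathbf S$-connected if (1) for every maximal $\mathbf S$-cadet sequence $Y$ of $T$, $X\cap Y=\emptyset$ or $Y\subseteq X$, and (2) no cadet sequence satisfying (1) is properly contained in $X$; its maximal $\mathbf S$-cadet sequences are those of $T$ contained in $X$. For $X$ of length $k$, $r_{\mathbf S}(X)=\sum_B(-1)^{k-|B|}$ over all partitions $B$ of the nodes of $X$ into $\mathbf S$-cadet sequences. -}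

module Defs where

open import Data.Bool using (Bool; true; false; _∧_; _∨_; not; if_then_else_; T)
open import Data.Nat as ℕ using (ℕ; zero; suc; _⊔_; _∸_)
open import Data.Integer as ℤ using (ℤ; +_; -_; ∣_∣)
open import Data.Fin using (Fin)
import Data.Fin.Properties as FinP
open import Data.Vec using (Vec; []; _∷_)
open import Data.List as List using (List; []; _∷_; _++_; _∷ʳ_; length; map; concatMap; allFin; foldr; filter; last)
open import Data.List.Membership.Propositional using (_∈_; _∉_)
open import Data.List.Relation.Unary.Unique.Propositional using (Unique)
open import Data.List.Relation.Binary.Subset.Propositional using (_⊆_)
open import Data.List.Relation.Binary.Disjoint.Propositional using (Disjoint)
import Data.List.Membership.DecPropositional as DecMem
open import Data.Maybe using (Maybe; just; nothing; _<∣>_)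
open import Data.Product using (Σ; Σ-syntax; _×_; _,_)
open import Data.Sum using (_⊎_)
open import Relation.Binary using (Tri; tri<; tri≈; tri>)
open import Relation.Binary.PropositionalEquality using (_≡_; _≢_)
open import Relation.Nullary using (¬_; does; ¬?)

-- S i j is the (finite) set S_{i,j} of integers s with (x_i - x_j = s) ∈ 𝒜,
-- given as a list; it is only consulted for i < j (entries with i ≥ j
-- are ignored).

Deformation : ℕ → Set
Deformation n = Fin n → Fin n → List ℤ

maxAbs : List ℤ → ℕ
maxAbs = foldr (λ s acc → ∣ s ∣ ⊔ acc) 0

mOf : ∀ {n} → Deformation n → ℕ
mOf {n} S = foldr _⊔_ 0
  (concatMap (λ i → map (λ j → if does (i FinP.<? j) then maxAbs (S i j) else 0)
                         (allFin n))
             (allFin n))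

_∈ℤ?_ : ℤ → List ℤ → Bool
s ∈ℤ? ss = does (DecMem._∈?_ ℤ._≟_ s ss)

inSminus : ∀ {n} → Deformation n → Fin n → Fin n → ℕ → Bool
inSminus S a b s with FinP.<-cmp a b
... | tri< _ _ _ = (- (+ s)) ∈ℤ? S a b
... | tri≈ _ _ _ = false
... | tri> _ _ _ = does (s ℕ.≟ 0) ∨ ((+ s) ∈ℤ? S b a)

-- Trees of 𝒯^{(m)}(n): rooted plane trees; a node carries a label in
-- Fin n (labels 1..n written 0..n-1) and exactly m+1 ordered children.

data Tree (n m : ℕ) : Set where
  leaf : Tree n m
  node : Fin n → Vec (Tree n m) (suc m) → Tree n m

module _ {n m : ℕ} where

  mutual
    labels : Tree n m → List (Fin n)
    labels leaf        = []
    labels (node u cs) = u ∷ labelsV cs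

    labelsV : ∀ {k} → Vec (Tree n m) k → List (Fin n)
    labelsV []       = []
    labelsV (t ∷ ts) = labels t ++ labelsV ts

  Labelled : Tree n m → Set
  Labelled t = Unique (labels t) × (∀ i → i ∈ labels t)

  mutual
    childrenOf : Tree n m → Fin n → Maybe (Vec (Tree n m) (suc m))
    childrenOf leaf        u = nothing
    childrenOf (node w cs) u =
      if does (w FinP.≟ u) then just cs else childrenOfV cs u

    childrenOfV : ∀ {k} → Vec (Tree n m) k → Fin n → Maybe (Vec (Tree n m) (suc m))
    childrenOfV []       u = nothing
    childrenOfV (t ∷ ts) u = childrenOf t u <∣> childrenOfV ts u

  rightmostNode : ∀ {k} → Vec (Tree n m) k → Maybe (Fin n)
  rightmostNode []       = nothing
  rightmostNode (t ∷ ts) with rightmostNode ts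
  ... | just v  = just v
  ... | nothing with t
  ...   | leaf       = nothing
  ...   | node v _   = just v

  cadet : Tree n m → Fin n → Maybe (Fin n)
  cadet t u with childrenOf t u
  ... | nothing = nothing
  ... | just cs = rightmostNode cs

  posIn : ∀ {k} → Vec (Tree n m) k → Fin n → Maybe ℕ
  posIn []                v = nothing
  posIn (leaf ∷ ts)       v = Data.Maybe.map suc (posIn ts v)
    where import Data.Maybe
  posIn (node w _ ∷ ts)   v =
    if does (w FinP.≟ v) then just 0 else Data.Maybe.map suc (posIn ts v)
    where import Data.Maybe

  mutual
    lsibM : Tree n m → Fin n → Maybe ℕ
    lsibM leaf        v = nothing
    lsibM (node w cs) v = posIn cs v <∣> lsibMV cs v

    lsibMV : ∀ {k} → Vec (Tree n m) k → Fin n → Maybe ℕ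
    lsibMV []       v = nothing
    lsibMV (t ∷ ts) v = lsibM t v <∣> lsibMV ts v

  -- lsib(v) (0 for the root, which is never used)
  lsib : Tree n m → Fin n → ℕ
  lsib t v with lsibM t v
  ... | just p  = p
  ... | nothing = 0

  _==M_ : Maybe (Fin n) → Maybe (Fin n) → Bool
  just a  ==M just b  = does (a FinP.≟ b)
  nothing ==M nothing = true
  _       ==M _       = false

  isCadetSeq : Tree n m → List (Fin n) → Bool
  isCadetSeq t []            = false
  isCadetSeq t (v ∷ [])      = true
  isCadetSeq t (u ∷ v ∷ vs)  = (cadet t u ==M just v) ∧ isCadetSeq t (v ∷ vs)

  -- for a = v_i and rest = (v_{i+1},…): check for every j > i that
  -- Σ_{p=i+1}^{j} lsib(v_p) ∉ S⁻_{v_i,v_j}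
  okFrom : Deformation n → Tree n m → Fin n → ℕ → List (Fin n) → Bool
  okFrom S t a acc []       = true
  okFrom S t a acc (w ∷ ws) =
    not (inSminus S a w (acc ℕ.+ lsib t w)) ∧ okFrom S t a (acc ℕ.+ lsib t w) ws

  allPairsOk : Deformation n → Tree n m → List (Fin n) → Bool
  allPairsOk S t []       = true
  allPairsOk S t (a ∷ vs) = okFrom S t a 0 vs ∧ allPairsOk S t vs

  isSCadet : Deformation n → Tree n m → List (Fin n) → Bool
  isSCadet S t vs = isCadetSeq t vs ∧ allPairsOk S t vs

  CadetSeq : Tree n m → List (Fin n) → Set
  CadetSeq t vs = T (isCadetSeq t vs)

  SCadetSeq : Deformation n → Tree n m → List (Fin n) → Set
  SCadetSeq S t vs = T (isSCadet S t vs)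

  MaxCadetSeq : Tree n m → List (Fin n) → Set
  MaxCadetSeq t vs =
    CadetSeq t vs
    × (∀ v → last vs ≡ just v → cadet t v ≡ nothing)
    × (∀ v rest → vs ≡ v ∷ rest → ∀ u → cadet t u ≢ just v)

  MaxSCadetSeq : Deformation n → Tree n m → List (Fin n) → Set
  MaxSCadetSeq S t ys =
    Σ[ pre ∈ List (Fin n) ] Σ[ post ∈ List (Fin n) ]
      MaxCadetSeq t (pre ++ ys ++ post)
      × SCadetSeq S t ys
      × (pre ≡ [] ⊎ Σ[ pre' ∈ List (Fin n) ] Σ[ u ∈ Fin n ]
            (pre ≡ pre' ∷ʳ u × ¬ SCadetSeq S t (u ∷ ys)))
      × (post ≡ [] ⊎ Σ[ w ∈ Fin n ] Σ[ post' ∈ List (Fin n) ]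
            (post ≡ w ∷ post' × ¬ SCadetSeq S t (ys ∷ʳ w)))

  Cond1 : Deformation n → Tree n m → List (Fin n) → Set
  Cond1 S t xs = ∀ ys → MaxSCadetSeq S t ys → Disjoint xs ys ⊎ ys ⊆ xs

  SConnected : Deformation n → Tree n m → List (Fin n) → Set
  SConnected S t xs =
    CadetSeq t xs
    × Cond1 S t xs
    × (∀ zs → CadetSeq t zs → Cond1 S t zs → ¬ (zs ⊆ xs × ¬ (xs ⊆ zs)))

  MaxSCadetSeqOf : Deformation n → Tree n m → List (Fin n) → List (Fin n) → Set
  MaxSCadetSeqOf S t xs ys = MaxSCadetSeq S t ys × ys ⊆ xs

-- Set partitions of (the elements of) a list; blocks are sublists in the
-- original order. Every set partition occurs exactly once.

insertEach : ∀ {A : Set} → A → List (List A) → List (List (List A))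
insertEach x []       = []
insertEach x (b ∷ bs) = ((x ∷ b) ∷ bs) ∷ map (b ∷_) (insertEach x bs)

setPartitions : ∀ {A : Set} → List A → List (List (List A))
setPartitions []       = [] ∷ []
setPartitions (x ∷ xs) =
  concatMap (λ p → ((x ∷ []) ∷ p) ∷ insertEach x p) (setPartitions xs)

allᵇ : ∀ {A : Set} → (A → Bool) → List A → Bool
allᵇ p = foldr (λ a b → p a ∧ b) true

-- r_𝐒(X) = Σ_B (-1)^{k-|B|}, B ranging over partitions of the nodes of X
-- into 𝐒-cadet sequences (a block, listed in the order of X, forms an
-- 𝐒-cadet sequence iff it is one in that order, since cadet sequences go
-- from parent to child)
rS : ∀ {n m} → Deformation n → Tree n m → List (Fin n) → ℤ
rS S t xs = foldr ℤ._+_ (+ 0)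
  (map (λ B → if allᵇ (isSCadet S t) B
                then (ℤ.- (+ 1)) ℤ.^ (length xs ∸ length B)
                else + 0)
       (setPartitions xs))

LastBefore : ∀ {n} → List (Fin n) → List (Fin n) → List (Fin n) → Set
LastBefore xs ys zs =
  Σ[ i ∈ Fin (length xs) ] Σ[ j ∈ Fin (length xs) ]
    (i Data.Fin.< j × last ys ≡ just (List.lookup xs i) × last zs ≡ just (List.lookup xs j))
  where import Data.Fin

_∖_ : ∀ {n} → List (Fin n) → List (Fin n) → List (Fin n)
ys ∖ zs = filter (λ y → ¬? (DecMem._∈?_ FinP._≟_ y zs)) ys

module Submission where

open import Defs
open import Data.Bool using (Bool; true; false; _∧_; not; if_then_else_; T)
open import Data.Bool.Properties using (T-∧; T?)
open import Data.Empty using (⊥; ⊥-elim)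
open import Data.Fin as Fin using (Fin; toℕ)
import Data.Fin.Properties as FinP
open import Data.Integer as ℤ using (ℤ; +_; -_; _+_; _*_; _^_)
import Data.Integer.Properties as ℤP
open import Data.Integer.Solver using (module +-*-Solver)
open import Data.List as List using (List; []; _∷_; _++_; _∷ʳ_; length; last; lookup; map; concatMap; foldr)
import Data.List.Properties as ListP
open import Data.List.Membership.Propositional using (_∈_; _∉_)
import Data.List.Membership.Propositional.Properties as ∈P
import Data.List.Membership.DecPropositional as DecMem
open import Data.List.Relation.Binary.Subset.Propositional using (_⊆_)
open import Data.List.Relation.Unary.All as All using (All; []; _∷_)
import Data.List.Relation.Unary.All.Properties as AllP
open import Data.List.Relation.Unary.Any as Any using (Any; here; there)
import Data.List.Relation.Unary.Any.Properties as AnyP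
open import Data.List.Relation.Unary.Unique.Propositional using (Unique; []; _∷_)
open import Data.List.Relation.Unary.Unique.Propositional.Properties using (Unique[x∷xs]⇒x∉xs)
open import Data.List.Reverse using (Reverse; []; _∶_∶ʳ_; reverseView)
open import Data.Maybe using (Maybe; just; nothing; _<∣>_)
import Data.Maybe.Properties as MaybeP
open import Data.Nat as ℕ using (ℕ; zero; suc; _∸_; _≤_; _<_; z≤n; s≤s)
import Data.Nat.Properties as ℕP
open import Data.Product using (Σ; Σ-syntax; _×_; _,_; proj₁; proj₂)
open import Data.Sum as Sum using (_⊎_; inj₁; inj₂)
open import Data.Vec using (Vec; []; _∷_)
open import Data.Vec.Membership.Propositional using () renaming (_∈_ to _∈ᵥ_)
open import Data.Vec.Relation.Unary.Any using (here; there)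
open import Function using (_∘_; flip; Equivalence)
open import Relation.Binary using (tri<; tri≈; tri>)
open import Relation.Binary.PropositionalEquality
open import Relation.Nullary using (¬_; yes; no; ¬?)

-- Write X = x₁ x₂ … x_k. By minimality, the cadet sequence x₂ … x_k violates condition (1), so some
-- maximal 𝐒-cadet sequence Y = x₁ x₂ … is a prefix of X. If some 𝐒-cadet sequence x₂ b stops being
-- 𝐒-cadet when x₁ is prepended, the maximal 𝐒-cadet sequence Y′ through x₂ reaches beyond Y; then
-- X₁ = Y, X₂ = Y′ and X₁ ∖ X₂ = {x₁}. Otherwise prepending x₁ preserves 𝐒-cadetness of every block
-- starting with x₂. Now r_𝐒(X) = (-1)^k Σ_B Π_{b ∈ B} w(b), where w(b) = -1 if b is 𝐒-cadet and
-- 0 otherwise, and the partitions with {x₁} as a block cancel against those in which x₁ is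
-- joined to the block of x₂, so r_𝐒(X) = 0. The last two maximal 𝐒-cadet sequences are handled
-- by the mirror argument, splitting x_k off the block of x_{k-1}.


module _ {A : Set} where

  Unique-++⇒∉ : ∀ (xs : List A) {ys x} → Unique (xs ++ ys) → x ∈ xs → x ∉ ys
  Unique-++⇒∉ (_ ∷ xs) (x∉ ∷ _) (here refl) x∈ys = All.lookup x∉ (∈P.∈-++⁺ʳ xs x∈ys) refl
  Unique-++⇒∉ (_ ∷ xs) (_ ∷ u) (there x∈xs) x∈ys = Unique-++⇒∉ xs u x∈xs x∈ys

  Unique-++⁻ˡ : ∀ (xs : List A) {ys} → Unique (xs ++ ys) → Unique xs
  Unique-++⁻ˡ []       _        = []
  Unique-++⁻ˡ (x ∷ xs) (x∉ ∷ u) = AllP.++⁻ˡ xs x∉ ∷ Unique-++⁻ˡ xs u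

  Unique-++⁻ʳ : ∀ (xs : List A) {ys} → Unique (xs ++ ys) → Unique ys
  Unique-++⁻ʳ []       u       = u
  Unique-++⁻ʳ (x ∷ xs) (_ ∷ u) = Unique-++⁻ʳ xs u

  Unique⇒lookup-injective : ∀ {xs : List A} → Unique xs → ∀ {i j} → lookup xs i ≡ lookup xs j → i ≡ j
  Unique⇒lookup-injective {_ ∷ _}  _        {Fin.zero}  {Fin.zero}  _ = refl
  Unique⇒lookup-injective {_ ∷ xs} (x∉ ∷ _) {Fin.zero}  {Fin.suc j} e =
    ⊥-elim (All.lookup x∉ (subst (_∈ xs) (sym e) (∈P.∈-lookup j)) refl)
  Unique⇒lookup-injective {_ ∷ xs} (x∉ ∷ _) {Fin.suc i} {Fin.zero}  e =
    ⊥-elim (All.lookup x∉ (subst (_∈ xs) e (∈P.∈-lookup i)) refl)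
  Unique⇒lookup-injective {_ ∷ _}  (_ ∷ u)  {Fin.suc i} {Fin.suc j} e =
    cong Fin.suc (Unique⇒lookup-injective u e)

  last-∷ʳ : ∀ (xs : List A) x → last (xs ∷ʳ x) ≡ just x
  last-∷ʳ []           x = refl
  last-∷ʳ (_ ∷ [])     x = refl
  last-∷ʳ (_ ∷ y ∷ xs) x = last-∷ʳ (y ∷ xs) x

  last-++-∷ : ∀ (xs : List A) y ys → last (xs ++ y ∷ ys) ≡ last (y ∷ ys)
  last-++-∷ []           y ys = refl
  last-++-∷ (_ ∷ [])     y ys = refl
  last-++-∷ (_ ∷ x ∷ xs) y ys = last-++-∷ (x ∷ xs) y ys

  last⇒∷ʳ : ∀ (xs : List A) {x} → last xs ≡ just x → Σ[ ys ∈ List A ] xs ≡ ys ∷ʳ x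
  last⇒∷ʳ (_ ∷ [])     refl = [] , refl
  last⇒∷ʳ (y ∷ z ∷ xs) e    = let (ys , eq) = last⇒∷ʳ (z ∷ xs) e in y ∷ ys , cong (y ∷_) eq

  last-∈ : ∀ (xs : List A) {x} → last xs ≡ just x → x ∈ xs
  last-∈ xs e with last⇒∷ʳ xs e
  ... | ys , refl = ∈P.∈-++⁺ʳ ys (here refl)

  nonempty⇒∷ʳ : ∀ (xs : List A) → 0 < length xs → Σ[ ys ∈ List A ] Σ[ x ∈ A ] xs ≡ ys ∷ʳ x
  nonempty⇒∷ʳ xs _ with List.initLast xs
  nonempty⇒∷ʳ .(ys ∷ʳ x) _ | ys List.∷ʳ′ x = ys , x , refl

  length-∷ʳ : ∀ (xs : List A) x → length (xs ∷ʳ x) ≡ suc (length xs)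
  length-∷ʳ xs x = trans (ListP.length-++ xs) (ℕP.+-comm (length xs) 1)

  ++-≡-++-≤ : ∀ (ps qs rs ss : List A) → ps ++ qs ≡ rs ++ ss → length ps ≤ length rs →
    Σ[ ds ∈ List A ] (rs ≡ ps ++ ds × qs ≡ ds ++ ss)
  ++-≡-++-≤ []       qs rs       ss e _         = rs , refl , e
  ++-≡-++-≤ (p ∷ ps) qs (r ∷ rs) ss e (s≤s le) with refl , e′ ← ListP.∷-injective e =
    let (ds , e₁ , e₂) = ++-≡-++-≤ ps qs rs ss e′ le in ds , cong (p ∷_) e₁ , e₂

  ++-≡-++-< : ∀ (ps qs rs ss : List A) → ps ++ qs ≡ rs ++ ss → length ps < length rs →
    Σ[ d ∈ A ] Σ[ ds ∈ List A ] rs ≡ ps ++ d ∷ ds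
  ++-≡-++-< ps qs rs ss e lt with ++-≡-++-≤ ps qs rs ss e (ℕP.<⇒≤ lt)
  ... | [] , refl , _ = ⊥-elim (ℕP.<-irrefl (cong length (sym (ListP.++-identityʳ ps))) lt)
  ... | d ∷ ds , refl , _ = d , ds , refl

  index-of : ∀ {xs : List A} ps x qs → xs ≡ ps ++ x ∷ qs →
    Σ[ i ∈ Fin (length xs) ] (lookup xs i ≡ x × toℕ i ≡ length ps)
  index-of []       x qs refl = Fin.zero , refl , refl
  index-of (p ∷ ps) x qs refl = let (i , e , l) = index-of ps x qs refl in Fin.suc i , e , cong suc l

  Unique⇒index : ∀ {xs : List A} ps {x qs} → xs ≡ ps ++ x ∷ qs → Unique xs →
    ∀ i → lookup xs i ≡ x → toℕ i ≡ length ps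
  Unique⇒index ps e u i eq with j , eq′ , l ← index-of ps _ _ e =
    trans (cong toℕ (Unique⇒lookup-injective u (trans eq (sym eq′)))) l

  ++-∷ʳ-++ : ∀ (ps qs : List A) x rs → ps ++ (qs ∷ʳ x) ++ rs ≡ (ps ++ qs) ++ x ∷ rs
  ++-∷ʳ-++ ps qs x rs = trans (cong (ps ++_) (ListP.++-assoc qs (x ∷ []) rs)) (sym (ListP.++-assoc ps qs (x ∷ rs)))

  ∷ʳ≢[] : ∀ (xs : List A) {x} → xs ∷ʳ x ≢ []
  ∷ʳ≢[] []      ()
  ∷ʳ≢[] (_ ∷ _) ()

  length-++-∷ʳ : ∀ (ps qs : List A) x → length ps ℕ.+ length (qs ∷ʳ x) ≡ suc (length (ps ++ qs))
  length-++-∷ʳ ps qs x = begin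
    length ps ℕ.+ length (qs ∷ʳ x) ≡⟨ cong (length ps ℕ.+_) (length-∷ʳ qs x) ⟩
    length ps ℕ.+ suc (length qs)  ≡⟨ ℕP.+-suc (length ps) (length qs) ⟩
    suc (length ps ℕ.+ length qs)  ≡⟨ cong suc (sym (ListP.length-++ ps)) ⟩
    suc (length (ps ++ qs))      ∎
    where open ≡-Reasoning

∖-singleton : ∀ {n} (ps : List (Fin n)) {x qs Z} → All (_∈ Z) ps → x ∉ Z → All (_∈ Z) qs →
  (ps ++ x ∷ qs) ∖ Z ≡ x ∷ []
∖-singleton [] {Z = Z} []           x∉Z qs⊆Z =
  trans (ListP.filter-accept (λ y → ¬? (DecMem._∈?_ FinP._≟_ y Z)) x∉Z)
        (cong (_ ∷_) (ListP.filter-none (λ y → ¬? (DecMem._∈?_ FinP._≟_ y Z)) (All.map (λ y∈Z y∉Z → y∉Z y∈Z) qs⊆Z)))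
∖-singleton (p ∷ ps) {Z = Z} (p∈Z ∷ ps⊆Z) x∉Z qs⊆Z =
  trans (ListP.filter-reject (λ y → ¬? (DecMem._∈?_ FinP._≟_ y Z)) (λ p∉Z → p∉Z p∈Z))
        (∖-singleton ps ps⊆Z x∉Z qs⊆Z)

-- Two least elements of a strict total order

module _ {A : Set} (P : A → Set) (_<_ : A → A → Set) where

  OnlyBelow : A → A → Set
  OnlyBelow a b = P a × P b × a < b × (∀ c → P c → c < b → c ≡ a)

  OnlyBelow-unique : (∀ {a} → ¬ a < a) → (∀ {a b c} → a < b → b < c → a < c) →
    (∀ {a b} → P a → P b → a < b ⊎ a ≡ b ⊎ b < a) →
    ∀ {a b a′ b′} → OnlyBelow a b → OnlyBelow a′ b′ → a ≡ a′ × b ≡ b′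
  OnlyBelow-unique irrefl trans< compare (Pa , Pb , a<b , below-b) (Pa′ , Pb′ , a′<b′ , below-b′)
    with compare Pb Pb′
  ... | inj₁ b<b′ =
    ⊥-elim (irrefl (subst (_< _) (trans (below-b′ _ Pa (trans< a<b b<b′)) (sym (below-b′ _ Pb b<b′))) a<b))
  ... | inj₂ (inj₁ refl) = below-b′ _ Pa a<b , refl
  ... | inj₂ (inj₂ b′<b) =
    ⊥-elim (irrefl (subst (_< _) (trans (below-b _ Pa′ (trans< a′<b′ b′<b)) (sym (below-b _ Pb′ b′<b))) a′<b′))

<∣>-just : ∀ {A : Set} (a : Maybe A) {b x} → (a <∣> b) ≡ just x → a ≡ just x ⊎ (a ≡ nothing × b ≡ just x)
<∣>-just (just _) e = inj₁ e
<∣>-just nothing  e = inj₂ (refl , e)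

module _ {n m : ℕ} where

  private
    Tr = Tree n m

  properLabels : Tr → List (Fin n)
  properLabels leaf        = []
  properLabels (node _ cs) = labelsV cs

  ∈ᵥ⇒∈-labelsV : ∀ {k v ds} {cs : Vec Tr k} → node v ds ∈ᵥ cs → v ∈ labelsV cs
  ∈ᵥ⇒∈-labelsV {cs = _ ∷ _}  (here refl) = here refl
  ∈ᵥ⇒∈-labelsV {cs = c ∷ _}  (there m)   = ∈P.∈-++⁺ʳ (labels c) (∈ᵥ⇒∈-labelsV m)

  ∈ᵥ⇒length-labels-< : ∀ {k v ds} {cs : Vec Tr k} → node v ds ∈ᵥ cs → length (labelsV ds) < length (labelsV cs)
  ∈ᵥ⇒length-labels-< {ds = ds} {cs = _ ∷ cs} (here refl) =
    s≤s (ℕP.≤-trans (ℕP.m≤m+n _ (length (labelsV cs))) (ℕP.≤-reflexive (sym (ListP.length-++ (labelsV ds)))))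
  ∈ᵥ⇒length-labels-< {cs = c ∷ cs} (there m) =
    ℕP.≤-trans (ℕP.≤-trans (∈ᵥ⇒length-labels-< m) (ℕP.m≤n+m _ (length (labels c))))
               (ℕP.≤-reflexive (sym (ListP.length-++ (labels c))))

  mutual
    childrenOf-∉ : ∀ (s : Tr) {v} → v ∉ labels s → childrenOf s v ≡ nothing
    childrenOf-∉ leaf        _  = refl
    childrenOf-∉ (node w cs) {v} v∉ with w FinP.≟ v
    ... | yes refl = ⊥-elim (v∉ (here refl))
    ... | no _     = childrenOfV-∉ cs (v∉ ∘ there)

    childrenOfV-∉ : ∀ {k} (cs : Vec Tr k) {v} → v ∉ labelsV cs → childrenOfV cs v ≡ nothing
    childrenOfV-∉ []       _  = refl
    childrenOfV-∉ (c ∷ cs) v∉ rewrite childrenOf-∉ c (λ m → v∉ (∈P.∈-++⁺ˡ m)) =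
      childrenOfV-∉ cs (λ m → v∉ (∈P.∈-++⁺ʳ (labels c) m))

  mutual
    child∈properLabels : ∀ (s : Tr) {u cs v ds} → childrenOf s u ≡ just cs → node v ds ∈ᵥ cs → v ∈ properLabels s
    child∈properLabels (node w es) {u} e m with w FinP.≟ u
    ... | yes refl with refl ← e = ∈ᵥ⇒∈-labelsV m
    ... | no _ = child∈labelsV es e m

    child∈labelsV : ∀ {k} (es : Vec Tr k) {u cs v ds} → childrenOfV es u ≡ just cs → node v ds ∈ᵥ cs → v ∈ labelsV es
    child∈labelsV (e ∷ es) {u} eq m with <∣>-just (childrenOf e u) eq
    ... | inj₁ eq₁       = ∈P.∈-++⁺ˡ (properLabels⊆labels e (child∈properLabels e eq₁ m))
    ... | inj₂ (_ , eq₂) = ∈P.∈-++⁺ʳ (labels e) (child∈labelsV es eq₂ m)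

    properLabels⊆labels : ∀ (s : Tr) {v} → v ∈ properLabels s → v ∈ labels s
    properLabels⊆labels (node _ _) m = there m

  private
    childrenOfV-∈ᵥ : ∀ {k} (es : Vec Tr k) {v ds} → Unique (labelsV es) → node v ds ∈ᵥ es → childrenOfV es v ≡ just ds
    childrenOfV-∈ᵥ (node v ds ∷ es) _ (here refl) with v FinP.≟ v
    ... | yes _ = refl
    ... | no v≢v = ⊥-elim (v≢v refl)
    childrenOfV-∈ᵥ (e ∷ es) u (there m)
      rewrite childrenOf-∉ e (λ v∈e → Unique-++⇒∉ (labels e) u v∈e (∈ᵥ⇒∈-labelsV m)) =
      childrenOfV-∈ᵥ es (Unique-++⁻ʳ (labels e) u) m

  mutual
    childrenOf-child : ∀ (s : Tr) {u cs v ds} → Unique (labels s) →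
      childrenOf s u ≡ just cs → node v ds ∈ᵥ cs → childrenOf s v ≡ just ds
    childrenOf-child (node w es) {u} {v = v} uq@(_ ∷ u′) eq m with w FinP.≟ u
    ... | yes refl with refl ← eq with w FinP.≟ v
    ...   | yes refl = ⊥-elim (Unique[x∷xs]⇒x∉xs uq (∈ᵥ⇒∈-labelsV m))
    ...   | no _     = childrenOfV-∈ᵥ es u′ m
    childrenOf-child (node w es) {u} {v = v} uq@(_ ∷ u′) eq m | no _ with w FinP.≟ v
    ... | yes refl = ⊥-elim (Unique[x∷xs]⇒x∉xs uq (child∈labelsV es eq m))
    ... | no _     = childrenOfV-child es u′ eq m

    childrenOfV-child : ∀ {k} (es : Vec Tr k) {u cs v ds} → Unique (labelsV es) →
      childrenOfV es u ≡ just cs → node v ds ∈ᵥ cs → childrenOfV es v ≡ just ds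
    childrenOfV-child (e ∷ es) {u} uq eq m with <∣>-just (childrenOf e u) eq
    ... | inj₁ eq₁ rewrite childrenOf-child e (Unique-++⁻ˡ (labels e) uq) eq₁ m = refl
    ... | inj₂ (_ , eq₂)
      rewrite childrenOf-∉ e (λ v∈e → Unique-++⇒∉ (labels e) uq v∈e (child∈labelsV es eq₂ m)) =
      childrenOfV-child es (Unique-++⁻ʳ (labels e) uq) eq₂ m

  mutual
    parent-unique : ∀ (s : Tr) {u u′ cs cs′ v ds ds′} → Unique (labels s) →
      childrenOf s u ≡ just cs → node v ds ∈ᵥ cs →
      childrenOf s u′ ≡ just cs′ → node v ds′ ∈ᵥ cs′ → u ≡ u′
    parent-unique (node w es) {u} {u′} (_ ∷ uq) e₁ m₁ e₂ m₂ with w FinP.≟ u | w FinP.≟ u′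
    ... | yes refl | yes refl = refl
    ... | yes refl | no _ with refl ← e₁ = ⊥-elim (root-child-not-nested es uq m₁ e₂ m₂)
    ... | no _ | yes refl with refl ← e₂ = ⊥-elim (root-child-not-nested es uq m₂ e₁ m₁)
    ... | no _ | no _ = parentV-unique es uq e₁ m₁ e₂ m₂

    parentV-unique : ∀ {k} (es : Vec Tr k) {u u′ cs cs′ v ds ds′} → Unique (labelsV es) →
      childrenOfV es u ≡ just cs → node v ds ∈ᵥ cs →
      childrenOfV es u′ ≡ just cs′ → node v ds′ ∈ᵥ cs′ → u ≡ u′
    parentV-unique (e ∷ es) {u} {u′} uq e₁ m₁ e₂ m₂
      with <∣>-just (childrenOf e u) e₁ | <∣>-just (childrenOf e u′) e₂
    ... | inj₁ f₁ | inj₁ f₂ = parent-unique e (Unique-++⁻ˡ (labels e) uq) f₁ m₁ f₂ m₂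
    ... | inj₁ f₁ | inj₂ (_ , f₂) =
      ⊥-elim (Unique-++⇒∉ (labels e) uq (properLabels⊆labels e (child∈properLabels e f₁ m₁)) (child∈labelsV es f₂ m₂))
    ... | inj₂ (_ , f₁) | inj₁ f₂ =
      ⊥-elim (Unique-++⇒∉ (labels e) uq (properLabels⊆labels e (child∈properLabels e f₂ m₂)) (child∈labelsV es f₁ m₁))
    ... | inj₂ (_ , f₁) | inj₂ (_ , f₂) = parentV-unique es (Unique-++⁻ʳ (labels e) uq) f₁ m₁ f₂ m₂

    root-child-not-nested : ∀ {k} (es : Vec Tr k) {u′ cs′ v ds ds′} → Unique (labelsV es) →
      node v ds ∈ᵥ es → childrenOfV es u′ ≡ just cs′ → node v ds′ ∈ᵥ cs′ → ⊥
    root-child-not-nested (e ∷ es) {u′} uq (here refl) e₂ m₂ with <∣>-just (childrenOf e u′) e₂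
    ... | inj₁ f₂       = Unique[x∷xs]⇒x∉xs (Unique-++⁻ˡ (labels e) uq) (child∈properLabels e f₂ m₂)
    ... | inj₂ (_ , f₂) = Unique-++⇒∉ (labels e) uq (here refl) (child∈labelsV es f₂ m₂)
    root-child-not-nested (e ∷ es) {u′} uq (there m₁) e₂ m₂ with <∣>-just (childrenOf e u′) e₂
    ... | inj₁ f₂       =
      Unique-++⇒∉ (labels e) uq (properLabels⊆labels e (child∈properLabels e f₂ m₂)) (∈ᵥ⇒∈-labelsV m₁)
    ... | inj₂ (_ , f₂) = root-child-not-nested es (Unique-++⁻ʳ (labels e) uq) m₁ f₂ m₂

  rightmostNode⇒∈ᵥ : ∀ {k} (cs : Vec Tr k) {v} → rightmostNode cs ≡ just v → Σ[ ds ∈ Vec Tr (suc m) ] node v ds ∈ᵥ cs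
  rightmostNode⇒∈ᵥ (c ∷ cs) {v} eq with rightmostNode cs in eq′
  ... | just w with refl ← eq = let (ds , m) = rightmostNode⇒∈ᵥ cs eq′ in ds , there m
  ... | nothing with c | eq
  ...   | node w ds | refl = ds , here refl

  cadet⇒child : ∀ (t : Tr) {u v} → cadet t u ≡ just v →
    Σ[ cs ∈ Vec Tr (suc m) ] Σ[ ds ∈ Vec Tr (suc m) ] (childrenOf t u ≡ just cs × node v ds ∈ᵥ cs)
  cadet⇒child t {u} eq with childrenOf t u
  ... | just cs = let (ds , m) = rightmostNode⇒∈ᵥ cs eq in cs , ds , refl , m

  cadet-injective : ∀ (t : Tr) {u u′ v} → Unique (labels t) → cadet t u ≡ just v → cadet t u′ ≡ just v → u ≡ u′
  cadet-injective t uq e₁ e₂ =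
    let (_ , _ , f₁ , m₁) = cadet⇒child t e₁
        (_ , _ , f₂ , m₂) = cadet⇒child t e₂
    in parent-unique t uq f₁ m₁ f₂ m₂

  descendantCount : Tr → Fin n → ℕ
  descendantCount t v with childrenOf t v
  ... | just cs = length (labelsV cs)
  ... | nothing = 0

  cadet-descendantCount-< : ∀ (t : Tr) {u v} → Unique (labels t) → cadet t u ≡ just v →
    descendantCount t v < descendantCount t u
  cadet-descendantCount-< t {u} {v} uq eq =
    let (cs , ds , f₁ , m₁) = cadet⇒child t eq
    in subst₂ _<_ (sym (count-≡ v (childrenOf-child t uq f₁ m₁))) (sym (count-≡ u f₁)) (∈ᵥ⇒length-labels-< m₁)
    where
    count-≡ : ∀ w {cs} → childrenOf t w ≡ just cs → descendantCount t w ≡ length (labelsV cs)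
    count-≡ w e with childrenOf t w
    count-≡ w refl | just _ = refl

T-∧⁻ : ∀ x {y} → T (x ∧ y) → T x × T y
T-∧⁻ x = Equivalence.to (T-∧ {x})

T-∧⁺ : ∀ {x y} → T x → T y → T (x ∧ y)
T-∧⁺ p q = Equivalence.from T-∧ (p , q)

module CadetChains {n m : ℕ} (t : Tree n m) where

  data CadetChain : List (Fin n) → Set where
    []  : CadetChain []
    [_] : ∀ x → CadetChain (x ∷ [])
    _∷_ : ∀ {x y r} → cadet t x ≡ just y → CadetChain (y ∷ r) → CadetChain (x ∷ y ∷ r)

  ==M-just⇒≡ : ∀ mx {v} → T (_==M_ {n = n} {m = m} mx (just v)) → mx ≡ just v
  ==M-just⇒≡ (just a) {v} p with a FinP.≟ v
  ... | yes refl = refl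

  ≡⇒==M-just : ∀ {mx v} → mx ≡ just v → T (_==M_ {n = n} {m = m} mx (just v))
  ≡⇒==M-just {v = v} refl with v FinP.≟ v
  ... | yes _   = _
  ... | no v≢v = v≢v refl

  CadetSeq⇒CadetChain : ∀ xs → CadetSeq t xs → CadetChain xs
  CadetSeq⇒CadetChain (x ∷ [])     _ = [ x ]
  CadetSeq⇒CadetChain (x ∷ y ∷ xs) p =
    let (p₁ , p₂) = T-∧⁻ (_==M_ {n = n} {m = m} (cadet t x) (just y)) p
    in ==M-just⇒≡ (cadet t x) p₁ ∷ CadetSeq⇒CadetChain (y ∷ xs) p₂

  CadetChain⇒CadetSeq : ∀ {x xs} → CadetChain (x ∷ xs) → CadetSeq t (x ∷ xs)
  CadetChain⇒CadetSeq [ x ]   = _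
  CadetChain⇒CadetSeq (e ∷ c) = T-∧⁺ (≡⇒==M-just e) (CadetChain⇒CadetSeq c)

  CadetChain⇒CadetSeq-∷ʳ : ∀ xs {x} → CadetChain (xs ∷ʳ x) → CadetSeq t (xs ∷ʳ x)
  CadetChain⇒CadetSeq-∷ʳ []      = CadetChain⇒CadetSeq
  CadetChain⇒CadetSeq-∷ʳ (_ ∷ _) = CadetChain⇒CadetSeq

  CadetChain-++⁻ˡ : ∀ xs {ys} → CadetChain (xs ++ ys) → CadetChain xs
  CadetChain-++⁻ˡ []           _       = []
  CadetChain-++⁻ˡ (x ∷ [])     _       = [ x ]
  CadetChain-++⁻ˡ (x ∷ y ∷ xs) (e ∷ c) = e ∷ CadetChain-++⁻ˡ (y ∷ xs) c

  CadetChain-++⁻ʳ : ∀ xs {ys} → CadetChain (xs ++ ys) → CadetChain ys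
  CadetChain-++⁻ʳ []           c       = c
  CadetChain-++⁻ʳ (x ∷ []) {[]} _      = []
  CadetChain-++⁻ʳ (x ∷ []) {_ ∷ _} (_ ∷ c) = c
  CadetChain-++⁻ʳ (x ∷ y ∷ xs) (_ ∷ c) = CadetChain-++⁻ʳ (y ∷ xs) c

  CadetChain-step : ∀ xs {a b ys} → CadetChain (xs ++ a ∷ b ∷ ys) → cadet t a ≡ just b
  CadetChain-step []       (e ∷ _) = e
  CadetChain-step (x ∷ xs) c       = CadetChain-step xs (CadetChain-++⁻ʳ (x ∷ []) c)

  CadetChain-∷ʳ : ∀ xs {a b} → CadetChain (xs ∷ʳ a) → cadet t a ≡ just b → CadetChain ((xs ∷ʳ a) ∷ʳ b)
  CadetChain-∷ʳ []           _        e = e ∷ [ _ ]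
  CadetChain-∷ʳ (x ∷ [])     (e′ ∷ _) e = e′ ∷ (e ∷ [ _ ])
  CadetChain-∷ʳ (x ∷ y ∷ xs) (e′ ∷ c) e = e′ ∷ CadetChain-∷ʳ (y ∷ xs) c e

  CadetChain-last-step : ∀ xs {a b} → CadetChain ((xs ∷ʳ a) ∷ʳ b) → cadet t a ≡ just b
  CadetChain-last-step xs {a} {b} c = CadetChain-step xs (subst CadetChain (ListP.++-assoc xs (a ∷ []) (b ∷ [])) c)

  CadetChain-head-step : ∀ {a b xs} → CadetChain (a ∷ b ∷ xs) → cadet t a ≡ just b
  CadetChain-head-step (e ∷ _) = e

  ∷-prefix-comparable : ∀ {a} ps qs → CadetChain (a ∷ ps) → CadetChain (a ∷ qs) →
    (Σ[ rs ∈ List (Fin n) ] qs ≡ ps ++ rs) ⊎ (Σ[ rs ∈ List (Fin n) ] ps ≡ qs ++ rs)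
  ∷-prefix-comparable []       qs       _         _         = inj₁ (qs , refl)
  ∷-prefix-comparable (p ∷ ps) []       _         _         = inj₂ (p ∷ ps , refl)
  ∷-prefix-comparable (p ∷ ps) (q ∷ qs) (e₁ ∷ c₁) (e₂ ∷ c₂) with refl ← trans (sym e₁) e₂
    with ∷-prefix-comparable ps qs c₁ c₂
  ... | inj₁ (rs , eq) = inj₁ (rs , cong (p ∷_) eq)
  ... | inj₂ (rs , eq) = inj₂ (rs , cong (p ∷_) eq)

  module _ (uq : Unique (labels t)) where

    CadetChain-below : ∀ {x xs} → CadetChain (x ∷ xs) → All (λ y → descendantCount t y < descendantCount t x) xs
    CadetChain-below [ x ]   = []
    CadetChain-below (e ∷ c) =
      let lt = cadet-descendantCount-< t uq e
      in lt ∷ All.map (λ lt′ → ℕP.<-trans lt′ lt) (CadetChain-below c)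

    CadetChain⇒Unique : ∀ {xs} → CadetChain xs → Unique xs
    CadetChain⇒Unique []    = []
    CadetChain⇒Unique [ x ] = [] ∷ []
    CadetChain⇒Unique c@(_ ∷ c′) =
      All.map (λ lt eq → ℕP.<-irrefl (cong (descendantCount t) (sym eq)) lt) (CadetChain-below c) ∷ CadetChain⇒Unique c′

    CadetChain-closed : ∀ xs {l c} → CadetChain xs → last xs ≡ just l → cadet t l ≡ just c → c ∉ xs
    CadetChain-closed xs chain el ec c∈ with last⇒∷ʳ xs el
    ... | ys , refl =
      Unique-++⇒∉ (ys ∷ʳ _) (CadetChain⇒Unique (CadetChain-∷ʳ ys chain ec)) c∈ (here refl)

    private
      CadetChain-continues : ∀ {W z} Z W′ → CadetChain W → last W ≡ last (z ∷ W′) →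
        CadetChain (z ∷ W′) → CadetChain (z ∷ Z) → Z ⊆ W → Σ[ B ∈ List (Fin n) ] W′ ≡ Z ++ B
      CadetChain-continues []       W′       _ _  _        _        _   = W′ , refl
      CadetChain-continues (z₁ ∷ Z) []       cW el _        (e ∷ _)  sub = ⊥-elim (CadetChain-closed _ cW el e (sub (here refl)))
      CadetChain-continues (z₁ ∷ Z) (w ∷ W′) cW el (e₁ ∷ c₁) (e₂ ∷ c₂) sub with refl ← trans (sym e₁) e₂ =
        let (B , eq) = CadetChain-continues Z W′ cW el c₁ c₂ (sub ∘ there) in B , cong (z₁ ∷_) eq

    CadetChain-segment : ∀ {W z Z} → CadetChain W → CadetChain (z ∷ Z) → z ∷ Z ⊆ W →
      Σ[ A ∈ List (Fin n) ] Σ[ B ∈ List (Fin n) ] W ≡ A ++ z ∷ Z ++ B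
    CadetChain-segment {z = z} {Z} cW cZ sub with ∈P.∈-∃++ (sub (here refl))
    ... | A , W′ , refl =
      let (B , eq) = CadetChain-continues Z W′ cW (last-++-∷ A z W′) (CadetChain-++⁻ʳ A cW) cZ (sub ∘ there)
      in A , B , cong (λ V → A ++ z ∷ V) eq

    private
      suffix-comparable : ∀ {ps qs a} → Reverse ps → Reverse qs →
        CadetChain (ps ∷ʳ a) → CadetChain (qs ∷ʳ a) →
        (Σ[ rs ∈ List (Fin n) ] qs ≡ rs ++ ps) ⊎ (Σ[ rs ∈ List (Fin n) ] ps ≡ rs ++ qs)
      suffix-comparable {qs = qs} [] _ _ _ = inj₁ (qs , sym (ListP.++-identityʳ qs))
      suffix-comparable {ps = ps} (_ ∶ _ ∶ʳ _) [] _ _ = inj₂ (ps , sym (ListP.++-identityʳ ps))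
      suffix-comparable (ps ∶ rps ∶ʳ p) (qs ∶ rqs ∶ʳ q) c₁ c₂
        with refl ← cadet-injective t uq (CadetChain-last-step ps c₁) (CadetChain-last-step qs c₂)
        with suffix-comparable rps rqs (CadetChain-++⁻ˡ (ps ∷ʳ p) c₁) (CadetChain-++⁻ˡ (qs ∷ʳ p) c₂)
      ... | inj₁ (rs , refl) = inj₁ (rs , ListP.++-assoc rs ps (p ∷ []))
      ... | inj₂ (rs , refl) = inj₂ (rs , ListP.++-assoc rs qs (p ∷ []))

    ∷ʳ-suffix-comparable : ∀ ps qs {a} → CadetChain (ps ∷ʳ a) → CadetChain (qs ∷ʳ a) →
      (Σ[ rs ∈ List (Fin n) ] qs ≡ rs ++ ps) ⊎ (Σ[ rs ∈ List (Fin n) ] ps ≡ rs ++ qs)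
    ∷ʳ-suffix-comparable ps qs = suffix-comparable (reverseView ps) (reverseView qs)

module SCadetSeqs {n m : ℕ} (S : Deformation n) (t : Tree n m) where

  open CadetChains t

  SCadetSeq⇒CadetChain : ∀ {xs} → SCadetSeq S t xs → CadetChain xs
  SCadetSeq⇒CadetChain {xs} p = CadetSeq⇒CadetChain xs (proj₁ (T-∧⁻ (isCadetSeq t xs) p))

  private
    okFrom-++⁻ˡ : ∀ a acc xs {ys} → T (okFrom S t a acc (xs ++ ys)) → T (okFrom S t a acc xs)
    okFrom-++⁻ˡ a acc []       _ = _
    okFrom-++⁻ˡ a acc (w ∷ xs) p =
      let (p₁ , p₂) = T-∧⁻ (not (inSminus S a w (acc ℕ.+ lsib t w))) p
      in T-∧⁺ p₁ (okFrom-++⁻ˡ a (acc ℕ.+ lsib t w) xs p₂)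

    allPairsOk-++⁻ˡ : ∀ xs {ys} → T (allPairsOk S t (xs ++ ys)) → T (allPairsOk S t xs)
    allPairsOk-++⁻ˡ []       _ = _
    allPairsOk-++⁻ˡ (a ∷ xs) {ys} p =
      let (p₁ , p₂) = T-∧⁻ (okFrom S t a 0 (xs ++ ys)) p
      in T-∧⁺ (okFrom-++⁻ˡ a 0 xs p₁) (allPairsOk-++⁻ˡ xs p₂)

  SCadetSeq-++⁻ˡ : ∀ x xs {ys} → SCadetSeq S t ((x ∷ xs) ++ ys) → SCadetSeq S t (x ∷ xs)
  SCadetSeq-++⁻ˡ x xs {ys} p =
    let (p₁ , p₂) = T-∧⁻ (isCadetSeq t ((x ∷ xs) ++ ys)) p
    in T-∧⁺ (CadetChain⇒CadetSeq (CadetChain-++⁻ˡ (x ∷ xs) (CadetSeq⇒CadetChain _ p₁))) (allPairsOk-++⁻ˡ (x ∷ xs) p₂)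

  SCadetSeq-∷⁻ : ∀ a h r → SCadetSeq S t (a ∷ h ∷ r) → SCadetSeq S t (h ∷ r)
  SCadetSeq-∷⁻ a h r p =
    let (p₁ , p₂) = T-∧⁻ (isCadetSeq t (a ∷ h ∷ r)) p
    in T-∧⁺ (proj₂ (T-∧⁻ (_==M_ {n = n} {m = m} (cadet t a) (just h)) p₁)) (proj₂ (T-∧⁻ (okFrom S t a 0 (h ∷ r)) p₂))

  SCadetSeq-infix : ∀ ps q qs rs → SCadetSeq S t (ps ++ (q ∷ qs) ++ rs) → SCadetSeq S t (q ∷ qs)
  SCadetSeq-infix []           q qs rs p = SCadetSeq-++⁻ˡ q qs p
  SCadetSeq-infix (a ∷ [])     q qs rs p = SCadetSeq-infix [] q qs rs (SCadetSeq-∷⁻ a q (qs ++ rs) p)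
  SCadetSeq-infix (a ∷ b ∷ ps) q qs rs p = SCadetSeq-infix (b ∷ ps) q qs rs (SCadetSeq-∷⁻ a b (ps ++ (q ∷ qs) ++ rs) p)

  SCadetSeq-++⁻ʳ : ∀ ps q qs → SCadetSeq S t (ps ++ q ∷ qs) → SCadetSeq S t (q ∷ qs)
  SCadetSeq-++⁻ʳ ps q qs p =
    SCadetSeq-infix ps q qs [] (subst (λ V → SCadetSeq S t (ps ++ V)) (sym (ListP.++-identityʳ (q ∷ qs))) p)

  SCadetSeq-∷ʳ⁻ : ∀ xs x y → SCadetSeq S t ((xs ∷ʳ x) ∷ʳ y) → SCadetSeq S t (xs ∷ʳ x)
  SCadetSeq-∷ʳ⁻ []       x y p = SCadetSeq-++⁻ˡ x [] {y ∷ []} p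
  SCadetSeq-∷ʳ⁻ (h ∷ xs) x y p = SCadetSeq-++⁻ˡ h (xs ∷ʳ x) {y ∷ []} p

  SCadetSeq-++-∷ʳ⁻ʳ : ∀ ps qs x → SCadetSeq S t (ps ++ qs ∷ʳ x) → SCadetSeq S t (qs ∷ʳ x)
  SCadetSeq-++-∷ʳ⁻ʳ ps []       x p = SCadetSeq-++⁻ʳ ps x [] p
  SCadetSeq-++-∷ʳ⁻ʳ ps (q ∷ qs) x p = SCadetSeq-++⁻ʳ ps q (qs ∷ʳ x) p

module MaxSCadetSeqs {n m : ℕ} (S : Deformation n) (t : Tree n m) (uq : Unique (labels t)) where

  open CadetChains t
  open SCadetSeqs S t

  MaxSCadetSeq⇒SCadetSeq : ∀ {ys} → MaxSCadetSeq S t ys → SCadetSeq S t ys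
  MaxSCadetSeq⇒SCadetSeq (_ , _ , _ , sc , _) = sc

  MaxSCadetSeq⇒∷ʳ : ∀ {ys} → MaxSCadetSeq S t ys → Σ[ zs ∈ List (Fin n) ] Σ[ z ∈ Fin n ] ys ≡ zs ∷ʳ z
  MaxSCadetSeq⇒∷ʳ {ys} (_ , _ , _ , sc , _) with List.initLast ys | sc
  ... | zs List.∷ʳ′ z | _ = zs , z , refl

  MaxSCadetSeq⇒nonempty : ∀ {ys} → MaxSCadetSeq S t ys → 0 < length ys
  MaxSCadetSeq⇒nonempty {_ ∷ _} _ = s≤s z≤n
  MaxSCadetSeq⇒nonempty {[]} (_ , _ , _ , () , _)

  MaxCadetSeq-next : ∀ pre ys post {w} → MaxCadetSeq t (pre ++ ys ++ post) → 0 < length ys →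
    CadetChain (ys ∷ʳ w) → Σ[ post′ ∈ List (Fin n) ] post ≡ w ∷ post′
  MaxCadetSeq-next pre ys post mc ne c with nonempty⇒∷ʳ ys ne
  MaxCadetSeq-next pre _ [] (_ , no-cadet , _) _ c | ys′ , l , refl
    with () ← trans (sym (no-cadet l (trans (cong last (++-∷ʳ-++ pre ys′ l [])) (last-∷ʳ (pre ++ ys′) l))))
                    (CadetChain-last-step ys′ c)
  MaxCadetSeq-next pre _ (w′ ∷ post′) (cs , _) _ c | ys′ , l , refl
    with refl ← trans (sym (CadetChain-last-step ys′ c)) (CadetChain-step (pre ++ ys′)
                  (subst CadetChain (++-∷ʳ-++ pre ys′ l (w′ ∷ post′)) (CadetSeq⇒CadetChain _ cs)))
    = post′ , refl

  MaxCadetSeq-previous : ∀ pre ys post {w} → MaxCadetSeq t (pre ++ ys ++ post) → 0 < length ys →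
    CadetChain (w ∷ ys) → Σ[ pre′ ∈ List (Fin n) ] pre ≡ pre′ ∷ʳ w
  MaxCadetSeq-previous pre (h ∷ ys) post (cs , _ , no-parent) _ (ew ∷ _) with List.initLast pre
  ... | [] = ⊥-elim (no-parent h (ys ++ post) refl _ ew)
  ... | pre′ List.∷ʳ′ u
    with refl ← cadet-injective t uq
                  (CadetChain-step pre′ (subst CadetChain (ListP.++-assoc pre′ (u ∷ []) _) (CadetSeq⇒CadetChain _ cs))) ew
    = pre′ , refl

  MaxSCadetSeq-∷ʳ : ∀ {ys} w → MaxSCadetSeq S t ys → ¬ SCadetSeq S t (ys ∷ʳ w)
  MaxSCadetSeq-∷ʳ {ys} w msc@(pre , post , mc , _ , _ , right) sc
    with post′ , refl ← MaxCadetSeq-next pre ys post mc (MaxSCadetSeq⇒nonempty msc) (SCadetSeq⇒CadetChain sc)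
    with right
  ... | inj₂ (_ , _ , refl , ¬sc) = ¬sc sc

  MaxSCadetSeq-∷ : ∀ {ys} p → MaxSCadetSeq S t ys → ¬ SCadetSeq S t (p ∷ ys)
  MaxSCadetSeq-∷ {ys} p msc@(pre , post , mc , _ , left , _) sc
    with pre′ , refl ← MaxCadetSeq-previous pre ys post mc (MaxSCadetSeq⇒nonempty msc) (SCadetSeq⇒CadetChain {p ∷ ys} sc)
    with left
  ... | inj₁ pre≡[] = ∷ʳ≢[] pre′ pre≡[]
  ... | inj₂ (_ , _ , e , ¬sc) with refl ← ListP.∷ʳ-injectiveʳ pre′ _ e = ¬sc sc

  MaxSCadetSeq-++ʳ : ∀ {ys} r rs → MaxSCadetSeq S t ys → ¬ SCadetSeq S t (ys ++ r ∷ rs)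
  MaxSCadetSeq-++ʳ {y ∷ ys} r rs msc sc =
    MaxSCadetSeq-∷ʳ r msc
      (SCadetSeq-++⁻ˡ y (ys ∷ʳ r) (subst (λ V → SCadetSeq S t (y ∷ V)) (sym (ListP.++-assoc ys (r ∷ []) rs)) sc))

  MaxSCadetSeq-++ˡ : ∀ {ys} rs r → MaxSCadetSeq S t ys → ¬ SCadetSeq S t (rs ++ r ∷ ys)
  MaxSCadetSeq-++ˡ {ys} rs r msc sc = MaxSCadetSeq-∷ r msc (SCadetSeq-++⁻ʳ rs r ys sc)

  MaxSCadetSeq-infix : ∀ ds {ys} r rs → MaxSCadetSeq S t ys → ¬ SCadetSeq S t (ds ++ ys ++ r ∷ rs)
  MaxSCadetSeq-infix ds {y ∷ ys} r rs msc sc = MaxSCadetSeq-++ʳ r rs msc (SCadetSeq-++⁻ʳ ds y (ys ++ r ∷ rs) sc)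

  private
    no-proper-prefix : ∀ {h} Z rs → MaxSCadetSeq S t (h ∷ Z) → SCadetSeq S t (h ∷ Z ++ rs) → rs ≡ []
    no-proper-prefix Z []       _   _  = refl
    no-proper-prefix Z (r ∷ rs) msc sc = ⊥-elim (MaxSCadetSeq-++ʳ r rs msc sc)

    no-proper-suffix : ∀ rs Z {l} → MaxSCadetSeq S t (Z ∷ʳ l) → SCadetSeq S t ((rs ++ Z) ∷ʳ l) → rs ≡ []
    no-proper-suffix rs Z {l} msc sc with List.initLast rs
    ... | [] = refl
    ... | rs′ List.∷ʳ′ r = ⊥-elim (MaxSCadetSeq-++ˡ rs′ r msc (subst (SCadetSeq S t) eq sc))
      where eq : ((rs′ ∷ʳ r) ++ Z) ∷ʳ l ≡ rs′ ++ r ∷ (Z ∷ʳ l)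
            eq = trans (ListP.++-assoc (rs′ ∷ʳ r) Z (l ∷ [])) (ListP.++-assoc rs′ (r ∷ []) (Z ∷ʳ l))

  MaxSCadetSeq-head-injective : ∀ {h Z W} → MaxSCadetSeq S t (h ∷ Z) → MaxSCadetSeq S t (h ∷ W) → Z ≡ W
  MaxSCadetSeq-head-injective {h} {Z} {W} mZ mW
    with ∷-prefix-comparable Z W (SCadetSeq⇒CadetChain (MaxSCadetSeq⇒SCadetSeq mZ))
                                 (SCadetSeq⇒CadetChain (MaxSCadetSeq⇒SCadetSeq mW))
  ... | inj₁ (rs , refl) with refl ← no-proper-prefix Z rs mZ (MaxSCadetSeq⇒SCadetSeq mW) = sym (ListP.++-identityʳ Z)
  ... | inj₂ (rs , refl) with refl ← no-proper-prefix W rs mW (MaxSCadetSeq⇒SCadetSeq mZ) = ListP.++-identityʳ W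

  MaxSCadetSeq-last-injective : ∀ {Z W} → MaxSCadetSeq S t Z → MaxSCadetSeq S t W → last Z ≡ last W → Z ≡ W
  MaxSCadetSeq-last-injective mZ mW e with MaxSCadetSeq⇒∷ʳ mZ | MaxSCadetSeq⇒∷ʳ mW
  ... | Z , l , refl | W , l′ , refl
    with refl ← trans (trans (sym (last-∷ʳ Z l)) e) (last-∷ʳ W l′)
    with ∷ʳ-suffix-comparable uq Z W (SCadetSeq⇒CadetChain (MaxSCadetSeq⇒SCadetSeq mZ))
                                    (SCadetSeq⇒CadetChain (MaxSCadetSeq⇒SCadetSeq mW))
  ... | inj₁ (rs , refl) with refl ← no-proper-suffix rs Z mZ (MaxSCadetSeq⇒SCadetSeq mW) = refl
  ... | inj₂ (rs , refl) with refl ← no-proper-suffix rs W mW (MaxSCadetSeq⇒SCadetSeq mZ) = refl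

  -- The two non-extensibility clauses of MaxSCadetSeq.
  Blockedʳ : List (Fin n) → List (Fin n) → Set
  Blockedʳ ys post =
    post ≡ [] ⊎ Σ[ w ∈ Fin n ] Σ[ post′ ∈ List (Fin n) ] (post ≡ w ∷ post′ × ¬ SCadetSeq S t (ys ∷ʳ w))

  Blockedˡ : List (Fin n) → List (Fin n) → Set
  Blockedˡ pre ys =
    pre ≡ [] ⊎ Σ[ pre′ ∈ List (Fin n) ] Σ[ u ∈ Fin n ] (pre ≡ pre′ ∷ʳ u × ¬ SCadetSeq S t (u ∷ ys))

  SCadetSeq-extendʳ : ∀ ys → SCadetSeq S t ys → ∀ rest →
    Σ[ es ∈ List (Fin n) ] Σ[ post ∈ List (Fin n) ]
      (rest ≡ es ++ post × SCadetSeq S t (ys ++ es) × Blockedʳ (ys ++ es) post)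
  SCadetSeq-extendʳ ys sc [] = [] , [] , refl , subst (SCadetSeq S t) (sym (ListP.++-identityʳ ys)) sc , inj₁ refl
  SCadetSeq-extendʳ ys sc (r ∷ rest) with T? (isSCadet S t (ys ∷ʳ r))
  ... | no ¬sc = [] , r ∷ rest , refl , subst (SCadetSeq S t) (sym (ListP.++-identityʳ ys)) sc ,
                 inj₂ (r , rest , refl , subst (λ V → ¬ SCadetSeq S t (V ∷ʳ r)) (sym (ListP.++-identityʳ ys)) ¬sc)
  ... | yes sc′ with es , post , refl , sc″ , blocked ← SCadetSeq-extendʳ (ys ∷ʳ r) sc′ rest =
    let eq = ListP.++-assoc ys (r ∷ []) es
    in r ∷ es , post , refl , subst (SCadetSeq S t) eq sc″ , subst (λ V → Blockedʳ V post) eq blocked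

  private
    extendˡ : ∀ ys {rest} → SCadetSeq S t ys → Reverse rest →
      Σ[ es ∈ List (Fin n) ] Σ[ pre ∈ List (Fin n) ]
        (rest ≡ pre ++ es × SCadetSeq S t (es ++ ys) × Blockedˡ pre (es ++ ys))
    extendˡ ys sc [] = [] , [] , refl , sc , inj₁ refl
    extendˡ ys sc (rest ∶ rrest ∶ʳ r) with T? (isSCadet S t (r ∷ ys))
    ... | no ¬sc = [] , rest ∷ʳ r , sym (ListP.++-identityʳ _) , sc , inj₂ (rest , r , refl , ¬sc)
    ... | yes sc′ with es , pre , refl , sc″ , blocked ← extendˡ (r ∷ ys) sc′ rrest =
      let eq = sym (ListP.++-assoc es (r ∷ []) ys)
      in es ∷ʳ r , pre , ListP.++-assoc pre es (r ∷ []) , subst (SCadetSeq S t) eq sc″ , subst (Blockedˡ pre) eq blocked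

  SCadetSeq-extendˡ : ∀ ys → SCadetSeq S t ys → ∀ rest →
    Σ[ es ∈ List (Fin n) ] Σ[ pre ∈ List (Fin n) ]
      (rest ≡ pre ++ es × SCadetSeq S t (es ++ ys) × Blockedˡ pre (es ++ ys))
  SCadetSeq-extendˡ ys sc rest = extendˡ ys sc (reverseView rest)

-- Sums over set partitions

sumℤ : List ℤ → ℤ
sumℤ = foldr _+_ (+ 0)

module PartitionSums {A : Set} where

  Partition : Set
  Partition = List (List A)

  sum-++ : ∀ (f : Partition → ℤ) ps qs → sumℤ (map f (ps ++ qs)) ≡ sumℤ (map f ps) + sumℤ (map f qs)
  sum-++ f []       qs = sym (ℤP.+-identityˡ _)
  sum-++ f (p ∷ ps) qs rewrite sum-++ f ps qs = sym (ℤP.+-assoc (f p) _ _)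

  sum-concatMap : ∀ (f : Partition → ℤ) (g : Partition → List Partition) ps →
    sumℤ (map f (concatMap g ps)) ≡ sumℤ (map (λ p → sumℤ (map f (g p))) ps)
  sum-concatMap f g []       = refl
  sum-concatMap f g (p ∷ ps) = trans (sum-++ f (g p) (concatMap g ps)) (cong (λ w → sumℤ (map f (g p)) + w) (sum-concatMap f g ps))

  sum-map : ∀ (f : Partition → ℤ) (g : Partition → Partition) ps → sumℤ (map f (map g ps)) ≡ sumℤ (map (f ∘ g) ps)
  sum-map f g []       = refl
  sum-map f g (p ∷ ps) = cong (λ w → f (g p) + w) (sum-map f g ps)

  sum-cong : ∀ {f g : Partition → ℤ} ps → All (λ p → f p ≡ g p) ps → sumℤ (map f ps) ≡ sumℤ (map g ps)
  sum-cong []       []         = refl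
  sum-cong (p ∷ ps) (eq ∷ eqs) = cong₂ _+_ eq (sum-cong ps eqs)

  sum-zero : ∀ {f : Partition → ℤ} ps → All (λ p → f p ≡ + 0) ps → sumℤ (map f ps) ≡ + 0
  sum-zero []       []         = refl
  sum-zero (p ∷ ps) (eq ∷ eqs) rewrite eq | sum-zero ps eqs = refl

  sum-neg : ∀ {f g : Partition → ℤ} ps → (∀ p → f p ≡ - g p) → sumℤ (map f ps) ≡ - sumℤ (map g ps)
  sum-neg []       _  = refl
  sum-neg {g = g} (p ∷ ps) eq rewrite eq p | sum-neg ps eq = sym (ℤP.neg-distrib-+ (g p) _)

  sum-scale : ∀ (f : Partition → ℤ) k ps → sumℤ (map (λ p → k * f p) ps) ≡ k * sumℤ (map f ps)
  sum-scale f k []       = sym (ℤP.*-zeroʳ k)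
  sum-scale f k (p ∷ ps) rewrite sum-scale f k ps = sym (ℤP.*-distribˡ-+ k (f p) _)

  All-concatMap : ∀ {P : Partition → Set} (g : Partition → List Partition) ps →
    All (λ p → All P (g p)) ps → All P (concatMap g ps)
  All-concatMap g []       []         = []
  All-concatMap g (p ∷ ps) (pp ∷ pps) = AllP.++⁺ pp (All-concatMap g ps pps)

  sum-insertEach-++ : ∀ (a : A) (F : Partition → ℤ) P Q →
    sumℤ (map F (insertEach a (P ++ Q))) ≡
      sumℤ (map (λ P′ → F (P′ ++ Q)) (insertEach a P)) + sumℤ (map (λ Q′ → F (P ++ Q′)) (insertEach a Q))
  sum-insertEach-++ a F []      Q = sym (ℤP.+-identityˡ _)
  sum-insertEach-++ a F (b ∷ P) Q = begin
      F ((a ∷ b) ∷ P ++ Q) + sumℤ (map F (map (b ∷_) (insertEach a (P ++ Q))))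
        ≡⟨ cong (λ w → F ((a ∷ b) ∷ P ++ Q) + w) (sum-map F (b ∷_) (insertEach a (P ++ Q))) ⟩
      F ((a ∷ b) ∷ P ++ Q) + sumℤ (map (F ∘ (b ∷_)) (insertEach a (P ++ Q)))
        ≡⟨ cong (λ w → F ((a ∷ b) ∷ P ++ Q) + w) (sum-insertEach-++ a (F ∘ (b ∷_)) P Q) ⟩
      F ((a ∷ b) ∷ P ++ Q) + (ΣP + ΣQ)
        ≡⟨ sym (ℤP.+-assoc (F ((a ∷ b) ∷ P ++ Q)) ΣP ΣQ) ⟩
      (F ((a ∷ b) ∷ P ++ Q) + ΣP) + ΣQ
        ≡⟨ cong (λ w → (F ((a ∷ b) ∷ P ++ Q) + w) + ΣQ)
                (sym (sum-map (λ P′ → F (P′ ++ Q)) (b ∷_) (insertEach a P))) ⟩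
      (F ((a ∷ b) ∷ P ++ Q) + sumℤ (map (λ P′ → F (P′ ++ Q)) (map (b ∷_) (insertEach a P)))) + ΣQ ∎
    where
    open ≡-Reasoning
    ΣP ΣQ : ℤ
    ΣP = sumℤ (map (λ P′ → F (b ∷ P′ ++ Q)) (insertEach a P))
    ΣQ = sumℤ (map (λ Q′ → F (b ∷ P ++ Q′)) (insertEach a Q))

  module Weighted (c : List A → ℤ) where

    weight : Partition → ℤ
    weight []      = + 1
    weight (b ∷ p) = c b * weight p

    weight-++ : ∀ P Q → weight (P ++ Q) ≡ weight P * weight Q
    weight-++ []      Q = sym (ℤP.*-identityˡ _)
    weight-++ (b ∷ P) Q rewrite weight-++ P Q = sym (ℤP.*-assoc (c b) _ _)

    extendSum : A → (Partition → ℤ) → Partition → ℤ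
    extendSum a F q = F ((a ∷ []) ∷ q) + sumℤ (map F (insertEach a q))

    sum-setPartitions-∷ : ∀ (F : Partition → ℤ) a L →
      sumℤ (map F (setPartitions (a ∷ L))) ≡ sumℤ (map (extendSum a F) (setPartitions L))
    sum-setPartitions-∷ F a L = sum-concatMap F (λ p → ((a ∷ []) ∷ p) ∷ insertEach a p) (setPartitions L)

    HeadsIn : List A → Partition → Set
    HeadsIn L q = All (λ b → Σ[ h ∈ A ] Σ[ r ∈ List A ] (b ≡ h ∷ r × h ∈ L)) q

    private
      HeadsIn-∷ : ∀ {x L q} → HeadsIn L q → HeadsIn (x ∷ L) q
      HeadsIn-∷ = All.map (λ (h , r , e , h∈) → h , r , e , there h∈)

      HeadsIn-insertEach : ∀ x L q → HeadsIn (x ∷ L) q → All (HeadsIn (x ∷ L)) (insertEach x q)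
      HeadsIn-insertEach x L []      []       = []
      HeadsIn-insertEach x L (b ∷ q) (hb ∷ hq) =
        ((x , b , refl , here refl) ∷ hq) ∷ AllP.map⁺ (All.map (hb ∷_) (HeadsIn-insertEach x L q hq))

      length-insertEach : ∀ x (q : Partition) → All (λ r → length r ≡ length q) (insertEach x q)
      length-insertEach x []      = []
      length-insertEach x (b ∷ q) = refl ∷ AllP.map⁺ (All.map (cong suc) (length-insertEach x q))

    setPartitions-HeadsIn : ∀ L → All (HeadsIn L) (setPartitions L)
    setPartitions-HeadsIn []      = [] ∷ []
    setPartitions-HeadsIn (x ∷ L) = All-concatMap (λ p → ((x ∷ []) ∷ p) ∷ insertEach x p) (setPartitions L)
      (All.map (λ {q} hq → ((x , [] , refl , here refl) ∷ HeadsIn-∷ hq) ∷ HeadsIn-insertEach x L q (HeadsIn-∷ hq))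
               (setPartitions-HeadsIn L))

    setPartitions-length-≤ : ∀ L → All (λ q → length q ≤ length L) (setPartitions L)
    setPartitions-length-≤ []      = z≤n ∷ []
    setPartitions-length-≤ (x ∷ L) = All-concatMap (λ p → ((x ∷ []) ∷ p) ∷ insertEach x p) (setPartitions L)
      (All.map (λ {q} lq → s≤s lq ∷ All.map (λ e → subst (_≤ suc (length L)) (sym e) (ℕP.m≤n⇒m≤1+n lq))
                                            (length-insertEach x q))
               (setPartitions-length-≤ L))

    -- Pairs the partition with block {x₁} against the one where x₁ joins the block of x₂;
    -- x₁ contributes nothing in front of any other block.
    module HeadCancellation (x₁ x₂ : A)
      (c-merge : ∀ b → c (x₁ ∷ x₂ ∷ b) ≡ c (x₂ ∷ b))
      (c-other : ∀ h b → h ≢ x₂ → c (x₁ ∷ h ∷ b) ≡ + 0)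
      (c-single : c (x₁ ∷ []) ≡ - + 1) where

      private
        NotHeadedBy-x₂ : List A → Set
        NotHeadedBy-x₂ b = Σ[ h ∈ A ] Σ[ r ∈ List A ] (b ≡ h ∷ r × h ≢ x₂)

        joinSum : Partition → ℤ
        joinSum q = sumℤ (map weight (insertEach x₁ q))

        joinSum-∷ : ∀ b q → joinSum (b ∷ q) ≡ c (x₁ ∷ b) * weight q + c b * joinSum q
        joinSum-∷ b q = cong (λ w → c (x₁ ∷ b) * weight q + w)
          (trans (sum-map weight (b ∷_) (insertEach x₁ q)) (sum-scale weight (c b) (insertEach x₁ q)))

        joinSum-zero : ∀ q → All NotHeadedBy-x₂ q → joinSum q ≡ + 0
        joinSum-zero []      []                     = refl
        joinSum-zero (b ∷ q) ((h , r , refl , h≢) ∷ hs)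
          rewrite joinSum-∷ b q | c-other h r h≢ | joinSum-zero q hs | ℤP.*-zeroʳ (c (h ∷ r)) = refl

        joinSum-insert-x₂ : ∀ q → All NotHeadedBy-x₂ q → All (λ r → joinSum r ≡ weight r) (insertEach x₂ q)
        joinSum-insert-x₂ []      []                 = []
        joinSum-insert-x₂ (b ∷ q) (hb ∷ hs′) =
          first ∷ AllP.map⁺ (All.map (λ {r} → later hb {r}) (joinSum-insert-x₂ q hs′))
          where
          first : joinSum ((x₂ ∷ b) ∷ q) ≡ weight ((x₂ ∷ b) ∷ q)
          first rewrite joinSum-∷ (x₂ ∷ b) q | c-merge b | joinSum-zero q hs′ | ℤP.*-zeroʳ (c (x₂ ∷ b)) = ℤP.+-identityʳ _
          later : NotHeadedBy-x₂ b → ∀ {r} → joinSum r ≡ weight r → joinSum (b ∷ r) ≡ weight (b ∷ r)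
          later (h , r′ , refl , h≢) {r} e rewrite joinSum-∷ (h ∷ r′) r | c-other h r′ h≢ | e = ℤP.+-identityˡ _

      sum-weight-head : ∀ L → x₂ ∉ L → sumℤ (map weight (setPartitions (x₁ ∷ x₂ ∷ L))) ≡ + 0
      sum-weight-head L x₂∉L = trans (sum-setPartitions-∷ weight x₁ (x₂ ∷ L))
        (sum-zero (setPartitions (x₂ ∷ L))
          (All-concatMap (λ p → ((x₂ ∷ []) ∷ p) ∷ insertEach x₂ p) (setPartitions L)
            (All.map (λ {q} hq → x₂-alone q (no-x₂ hq) ∷ All.map (λ {r} → x₂-joined {r}) (joinSum-insert-x₂ q (no-x₂ hq)))
                     (setPartitions-HeadsIn L))))
        where
        open +-*-Solver
        no-x₂ : ∀ {q} → HeadsIn L q → All NotHeadedBy-x₂ q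
        no-x₂ = All.map (λ (h , r , e , h∈) → h , r , e , λ { refl → x₂∉L h∈ })
        x₂-alone : ∀ q → All NotHeadedBy-x₂ q → extendSum x₁ weight ((x₂ ∷ []) ∷ q) ≡ + 0
        x₂-alone q hs = begin
            c (x₁ ∷ []) * (c (x₂ ∷ []) * weight q) + joinSum ((x₂ ∷ []) ∷ q)
              ≡⟨ cong₂ _+_ (cong (_* (c (x₂ ∷ []) * weight q)) c-single) (joinSum-∷ (x₂ ∷ []) q) ⟩
            - + 1 * (c (x₂ ∷ []) * weight q) + (c (x₁ ∷ x₂ ∷ []) * weight q + c (x₂ ∷ []) * joinSum q)
              ≡⟨ cong₂ (λ u v → - + 1 * (c (x₂ ∷ []) * weight q) + (u * weight q + c (x₂ ∷ []) * v))
                       (c-merge []) (joinSum-zero q hs) ⟩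
            - + 1 * (c (x₂ ∷ []) * weight q) + (c (x₂ ∷ []) * weight q + c (x₂ ∷ []) * + 0)
              ≡⟨ solve 2 (λ a b → (:- con (+ 1)) :* (a :* b) :+ (a :* b :+ a :* con (+ 0)) := con (+ 0))
                       refl (c (x₂ ∷ [])) (weight q) ⟩
            + 0 ∎
          where open ≡-Reasoning
        x₂-joined : ∀ {r} → joinSum r ≡ weight r → extendSum x₁ weight r ≡ + 0
        x₂-joined {r} e = begin
            c (x₁ ∷ []) * weight r + joinSum r ≡⟨ cong₂ _+_ (cong (_* weight r) c-single) e ⟩
            - + 1 * weight r + weight r        ≡⟨ solve 1 (λ a → (:- con (+ 1)) :* a :+ a := con (+ 0)) refl (weight r) ⟩
            + 0 ∎
          where open ≡-Reasoning

    -- Induction on pre: extendSum preserves NegatesOnSplit and VanishesOnZeroBlock, and for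
    -- pre = [] the two partitions of y ∷ z ∷ [] cancel.
    module TailCancellation (y z : A) (c-∷-zero : ∀ a h r → c (h ∷ r) ≡ + 0 → c (a ∷ h ∷ r) ≡ + 0) where

      ZeroBlock : List A → Set
      ZeroBlock b = Σ[ h ∈ A ] Σ[ r ∈ List A ] (b ≡ h ∷ r × c b ≡ + 0)

      NegatesOnSplit : (Partition → ℤ) → Set
      NegatesOnSplit F = ∀ P u → F (P ++ (u ∷ʳ y) ∷ (z ∷ []) ∷ []) ≡ - F (P ++ ((u ∷ʳ y) ∷ʳ z) ∷ [])

      VanishesOnZeroBlock : (Partition → ℤ) → Set
      VanishesOnZeroBlock F = ∀ q → Any ZeroBlock q → F q ≡ + 0

      private
        insertEach-ZeroBlock : ∀ a q → Any ZeroBlock q → All (Any ZeroBlock) (insertEach a q)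
        insertEach-ZeroBlock a (b ∷ q) (here (h , r , refl , e)) =
          here (a , h ∷ r , refl , c-∷-zero a h r e) ∷ AllP.map⁺ (All.tabulate (λ _ → here (h , r , refl , e)))
        insertEach-ZeroBlock a (b ∷ q) (there zb) = there zb ∷ AllP.map⁺ (All.map there (insertEach-ZeroBlock a q zb))

        extendSum-vanishes : ∀ a F → VanishesOnZeroBlock F → VanishesOnZeroBlock (extendSum a F)
        extendSum-vanishes a F vF q zb rewrite vF ((a ∷ []) ∷ q) (there zb) =
          trans (ℤP.+-identityˡ _) (sum-zero (insertEach a q) (All.map (vF _) (insertEach-ZeroBlock a q zb)))

        extendSum-negates : ∀ a F → c (a ∷ z ∷ []) ≡ + 0 → NegatesOnSplit F → VanishesOnZeroBlock F →
          NegatesOnSplit (extendSum a F)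
        extendSum-negates a F caz nF vF P u = begin
            F ((a ∷ []) ∷ P ++ Q₁) + sumℤ (map F (insertEach a (P ++ Q₁)))
              ≡⟨ cong (λ w → F ((a ∷ []) ∷ P ++ Q₁) + w) (sum-insertEach-++ a F P Q₁) ⟩
            F ((a ∷ []) ∷ P ++ Q₁) + (sumℤ (map (λ P′ → F (P′ ++ Q₁)) (insertEach a P))
                                      + sumℤ (map (λ Q′ → F (P ++ Q′)) (insertEach a Q₁)))
              ≡⟨ cong₂ (λ u₁ u₂ → u₁ + (u₂ + sumℤ (map (λ Q′ → F (P ++ Q′)) (insertEach a Q₁))))
                    (nF ((a ∷ []) ∷ P) u) (sum-neg (insertEach a P) (λ P′ → nF P′ u)) ⟩
            - F ((a ∷ []) ∷ P ++ Q₂)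
              + (- Σ₂ + (F (P ++ (a ∷ uy) ∷ (z ∷ []) ∷ []) + (F (P ++ uy ∷ (a ∷ z ∷ []) ∷ []) + + 0)))
              ≡⟨ cong₂ (λ u₁ u₂ → - F ((a ∷ []) ∷ P ++ Q₂) + (- Σ₂ + (u₁ + (u₂ + + 0))))
                    (nF P (a ∷ u))
                    (vF (P ++ uy ∷ (a ∷ z ∷ []) ∷ []) (AnyP.++⁺ʳ P (there (here (a , z ∷ [] , refl , caz))))) ⟩
            - F ((a ∷ []) ∷ P ++ Q₂) + (- Σ₂ + (- F (P ++ (a ∷ uyz) ∷ []) + (+ 0 + + 0)))
              ≡⟨ solve 3 (λ p q r → :- p :+ (:- q :+ (:- r :+ (con (+ 0) :+ con (+ 0)))) := :- (p :+ (q :+ (r :+ con (+ 0))))) refl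
                   (F ((a ∷ []) ∷ P ++ Q₂)) Σ₂ (F (P ++ (a ∷ uyz) ∷ [])) ⟩
            - (F ((a ∷ []) ∷ P ++ Q₂) + (Σ₂ + (F (P ++ (a ∷ uyz) ∷ []) + + 0)))
              ≡⟨ cong (λ w → - (F ((a ∷ []) ∷ P ++ Q₂) + w)) (sym (sum-insertEach-++ a F P Q₂)) ⟩
            - (F ((a ∷ []) ∷ P ++ Q₂) + sumℤ (map F (insertEach a (P ++ Q₂)))) ∎
          where
          open ≡-Reasoning
          open +-*-Solver
          uy uyz : List A
          uy = u ∷ʳ y
          uyz = uy ∷ʳ z
          Q₁ Q₂ : Partition
          Q₁ = uy ∷ (z ∷ []) ∷ []
          Q₂ = uyz ∷ []
          Σ₂ : ℤ
          Σ₂ = sumℤ (map (λ P′ → F (P′ ++ Q₂)) (insertEach a P))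

      private
        sum-tail : ∀ pre → All (λ a → c (a ∷ z ∷ []) ≡ + 0) pre → ∀ F → NegatesOnSplit F → VanishesOnZeroBlock F →
          sumℤ (map F (setPartitions (pre ++ y ∷ z ∷ []))) ≡ + 0
        sum-tail [] _ F nF _ rewrite nF [] [] = solve 1 (λ a → :- a :+ (a :+ con (+ 0)) := con (+ 0)) refl (F ((y ∷ z ∷ []) ∷ []))
          where open +-*-Solver
        sum-tail (a ∷ pre) (caz ∷ cs) F nF vF =
          trans (sum-setPartitions-∷ F a (pre ++ y ∷ z ∷ []))
                (sum-tail pre cs (extendSum a F) (extendSum-negates a F caz nF vF) (extendSum-vanishes a F vF))

        weight-vanishes : VanishesOnZeroBlock weight
        weight-vanishes (b ∷ q) (here (h , r , refl , e)) rewrite e = refl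
        weight-vanishes (b ∷ q) (there zb) rewrite weight-vanishes q zb = ℤP.*-zeroʳ (c b)

        weight-negates : c (z ∷ []) ≡ - + 1 → (∀ u → c ((u ∷ʳ y) ∷ʳ z) ≡ c (u ∷ʳ y)) → NegatesOnSplit weight
        weight-negates cz c-merge P u
          rewrite weight-++ P ((u ∷ʳ y) ∷ (z ∷ []) ∷ []) | weight-++ P (((u ∷ʳ y) ∷ʳ z) ∷ []) | cz | c-merge u =
          solve 2 (λ p q → p :* (q :* ((:- con (+ 1)) :* con (+ 1))) := :- (p :* (q :* con (+ 1)))) refl (weight P) (c (u ∷ʳ y))
          where open +-*-Solver

      sum-weight-tail : ∀ pre → All (λ a → c (a ∷ z ∷ []) ≡ + 0) pre → c (z ∷ []) ≡ - + 1 →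
        (∀ u → c ((u ∷ʳ y) ∷ʳ z) ≡ c (u ∷ʳ y)) → sumℤ (map weight (setPartitions (pre ++ y ∷ z ∷ []))) ≡ + 0
      sum-weight-tail pre c-pre cz c-merge = sum-tail pre c-pre weight (weight-negates cz c-merge) weight-vanishes

module SignedCount {A : Set} (p : List A → Bool) where

  open PartitionSums {A}

  blockWeight : List A → ℤ
  blockWeight b = if p b then - + 1 else + 0

  open Weighted blockWeight public

  signedCount : List A → ℤ
  signedCount xs = sumℤ (map (λ B → if allᵇ p B then (- + 1) ^ (length xs ∸ length B) else + 0) (setPartitions xs))

  private
    weight-allᵇ : ∀ B → weight B ≡ (if allᵇ p B then (- + 1) ^ length B else + 0)
    weight-allᵇ []      = refl
    weight-allᵇ (b ∷ B) with p b
    ... | false = refl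
    ... | true rewrite weight-allᵇ B with allᵇ p B
    ...   | true  = refl
    ...   | false = refl

    -1^-∸ : ∀ j k → j ≤ k → (- + 1) ^ (k ∸ j) ≡ (- + 1) ^ k * (- + 1) ^ j
    -1^-∸ zero    k       _         = sym (ℤP.*-identityʳ _)
    -1^-∸ (suc j) (suc k) (s≤s j≤k) rewrite -1^-∸ j k j≤k =
      solve 2 (λ a b → a :* b := ((:- con (+ 1)) :* a) :* ((:- con (+ 1)) :* b)) refl ((- + 1) ^ k) ((- + 1) ^ j)
      where open +-*-Solver

    term-weight : ∀ k B → length B ≤ k →
      (if allᵇ p B then (- + 1) ^ (k ∸ length B) else + 0) ≡ (- + 1) ^ k * weight B
    term-weight k B le rewrite weight-allᵇ B with allᵇ p B
    ... | true  = -1^-∸ (length B) k le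
    ... | false = sym (ℤP.*-zeroʳ ((- + 1) ^ k))

  signedCount-weight : ∀ xs → signedCount xs ≡ (- + 1) ^ length xs * sumℤ (map weight (setPartitions xs))
  signedCount-weight xs =
    trans (sum-cong (setPartitions xs) (All.map (λ {B} → term-weight (length xs) B) (setPartitions-length-≤ xs)))
          (sum-scale weight ((- + 1) ^ length xs) (setPartitions xs))

  signedCount≡0 : ∀ xs → sumℤ (map weight (setPartitions xs)) ≡ + 0 → signedCount xs ≡ + 0
  signedCount≡0 xs eq = trans (signedCount-weight xs) (trans (cong ((- + 1) ^ length xs *_) eq) (ℤP.*-zeroʳ ((- + 1) ^ length xs)))

  blockWeight-cong : ∀ a b → (T (p a) → T (p b)) → (T (p b) → T (p a)) → blockWeight a ≡ blockWeight b
  blockWeight-cong a b to from with p a | p b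
  ... | true  | true  = refl
  ... | false | false = refl
  ... | true  | false = ⊥-elim (to _)
  ... | false | true  = ⊥-elim (from _)

  blockWeight-zero : ∀ a → ¬ T (p a) → blockWeight a ≡ + 0
  blockWeight-zero a ¬pa with p a
  ... | true  = ⊥-elim (¬pa _)
  ... | false = refl

  blockWeight≡0⇒¬ : ∀ a → blockWeight a ≡ + 0 → ¬ T (p a)
  blockWeight≡0⇒¬ a eq pa with p a
  blockWeight≡0⇒¬ a () _ | true

module MaxSCadetSeqsOf {n m : ℕ} (S : Deformation n) (t : Tree n m) (uq : Unique (labels t))
  (X : List (Fin n)) (cX : CadetChains.CadetChain t X) (cond1 : Cond1 S t X) where

  open CadetChains t
  open SCadetSeqs S t
  open MaxSCadetSeqs S t uq

  X-unique : Unique X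
  X-unique = CadetChain⇒Unique uq cX

  MaxSCadetSeq-meets⇒⊆ : ∀ Y {v} → MaxSCadetSeq S t Y → v ∈ Y → v ∈ X → Y ⊆ X
  MaxSCadetSeq-meets⇒⊆ Y msc v∈Y v∈X with cond1 Y msc
  ... | inj₁ disjoint = ⊥-elim (disjoint (v∈X , v∈Y))
  ... | inj₂ Y⊆X      = Y⊆X

  MaxSCadetSeqOf⇒segment : ∀ Y → MaxSCadetSeqOf S t X Y → Σ[ A ∈ List (Fin n) ] Σ[ B ∈ List (Fin n) ] X ≡ A ++ Y ++ B
  MaxSCadetSeqOf⇒segment []      ((_ , _ , _ , () , _) , _)
  MaxSCadetSeqOf⇒segment (_ ∷ _) (msc , Y⊆X) =
    CadetChain-segment uq cX (SCadetSeq⇒CadetChain (MaxSCadetSeq⇒SCadetSeq msc)) Y⊆X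

  segment-last-index : ∀ A Z B → X ≡ A ++ Z ++ B → ∀ i → last Z ≡ just (lookup X i) →
    suc (toℕ i) ≡ length A ℕ.+ length Z
  segment-last-index A Z B eX i el with last⇒∷ʳ Z el
  ... | Z′ , refl = begin
    suc (toℕ i)                  ≡⟨ cong suc (Unique⇒index (A ++ Z′) (trans eX (++-∷ʳ-++ A Z′ _ B)) X-unique i
                                      (sym (MaybeP.just-injective (trans (sym (last-∷ʳ Z′ _)) el)))) ⟩
    suc (length (A ++ Z′))       ≡⟨ sym (length-++-∷ʳ A Z′ _) ⟩
    length A ℕ.+ length (Z′ ∷ʳ _)  ∎
    where open ≡-Reasoning

  segment-last : ∀ A Z B → X ≡ A ++ Z ++ B → 0 < length Z →
    Σ[ i ∈ Fin (length X) ] last Z ≡ just (lookup X i)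
  segment-last A Z B eX nonempty with nonempty⇒∷ʳ Z nonempty
  ... | Z′ , l , refl =
    let (i , eq , _) = index-of (A ++ Z′) l B (trans eX (++-∷ʳ-++ A Z′ l B))
    in i , trans (last-∷ʳ Z′ l) (cong just (sym eq))

  segments⇒LastBefore : ∀ A Z B A′ W B′ → X ≡ A ++ Z ++ B → X ≡ A′ ++ W ++ B′ →
    0 < length Z → 0 < length W → length A ℕ.+ length Z < length A′ ℕ.+ length W → LastBefore X Z W
  segments⇒LastBefore A Z B A′ W B′ eZ eW neZ neW lt =
    let (i , ei) = segment-last A Z B eZ neZ
        (j , ej) = segment-last A′ W B′ eW neW
    in i , j ,
       ℕP.+-cancelˡ-< 1 _ _ (subst₂ _<_ (sym (segment-last-index A Z B eZ i ei)) (sym (segment-last-index A′ W B′ eW j ej)) lt) ,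
       ei , ej

  LastBefore⇒segments : ∀ A Z B A′ W B′ → X ≡ A ++ Z ++ B → X ≡ A′ ++ W ++ B′ →
    LastBefore X Z W → length A ℕ.+ length Z < length A′ ℕ.+ length W
  LastBefore⇒segments A Z B A′ W B′ eZ eW (i , j , i<j , ei , ej) =
    subst₂ _<_ (segment-last-index A Z B eZ i ei) (segment-last-index A′ W B′ eW j ej) (s≤s i<j)

  LastBefore-irrefl : ∀ {Z} → LastBefore X Z Z → ⊥
  LastBefore-irrefl (i , j , i<j , ei , ej) =
    FinP.<-irrefl (Unique⇒lookup-injective X-unique (MaybeP.just-injective (trans (sym ei) ej))) i<j

  LastBefore-trans : ∀ {Z W V} → LastBefore X Z W → LastBefore X W V → LastBefore X Z V
  LastBefore-trans (i , j , i<j , ei , ej) (j′ , k , j′<k , ej′ , ek)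
    with refl ← Unique⇒lookup-injective X-unique (MaybeP.just-injective (trans (sym ej) ej′)) =
    i , k , FinP.<-trans i<j j′<k , ei , ek

  private
    last-index : ∀ {Z} → MaxSCadetSeqOf S t X Z → Σ[ i ∈ Fin (length X) ] last Z ≡ just (lookup X i)
    last-index (msc , Z⊆X) with MaxSCadetSeq⇒∷ʳ msc
    ... | Z , l , refl =
      let l∈X = Z⊆X (last-∈ (Z ∷ʳ l) (last-∷ʳ Z l))
      in Any.index l∈X , trans (last-∷ʳ Z l) (cong just (AnyP.lookup-index l∈X))

  LastBefore-compare : ∀ {Z W} → MaxSCadetSeqOf S t X Z → MaxSCadetSeqOf S t X W →
    LastBefore X Z W ⊎ Z ≡ W ⊎ LastBefore X W Z
  LastBefore-compare mZ mW with last-index mZ | last-index mW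
  ... | i , ei | j , ej with FinP.<-cmp i j
  ... | tri< i<j _ _ = inj₁ (i , j , i<j , ei , ej)
  ... | tri≈ _ refl _ = inj₂ (inj₁ (MaxSCadetSeq-last-injective (proj₁ mZ) (proj₁ mW) (trans ei (sym ej))))
  ... | tri> _ _ j<i = inj₂ (inj₂ (j , i , j<i , ej , ei))

  OnlyBelow-LastBefore-unique : ∀ {a b a′ b′} →
    OnlyBelow (MaxSCadetSeqOf S t X) (LastBefore X) a b → OnlyBelow (MaxSCadetSeqOf S t X) (LastBefore X) a′ b′ →
    a ≡ a′ × b ≡ b′
  OnlyBelow-LastBefore-unique = OnlyBelow-unique _ _ (λ {Z} → LastBefore-irrefl {Z}) (λ {Z} {W} {V} → LastBefore-trans {Z} {W} {V})
      (λ {Z} {W} → LastBefore-compare {Z} {W})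

  OnlyAbove-LastBefore-unique : ∀ {a b a′ b′} →
    OnlyBelow (MaxSCadetSeqOf S t X) (flip (LastBefore X)) a b → OnlyBelow (MaxSCadetSeqOf S t X) (flip (LastBefore X)) a′ b′ →
    a ≡ a′ × b ≡ b′
  OnlyAbove-LastBefore-unique =
    OnlyBelow-unique _ _ (λ {Z} → LastBefore-irrefl {Z}) (λ {Z} {W} {V} p q → LastBefore-trans {V} {W} {Z} q p)
      (λ {Z} {W} mZ mW → Sum.map₂ (Sum.map₁ sym) (LastBefore-compare {W} {Z} mW mZ))

module _ {n m : ℕ} (S : Deformation n) (t : Tree n m) where

  Cond1-remove : ∀ {X X′ e} → Cond1 S t X → X′ ⊆ X → (∀ {v} → v ∈ X → v ≢ e → v ∈ X′) →
    (∀ Y {v} → MaxSCadetSeq S t Y → e ∈ Y → v ∈ Y → v ∈ X′ → ⊥) → Cond1 S t X′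
  Cond1-remove {X′ = X′} {e} cond1 X′⊆X X⊆e∷X′ no-bridge Y msc with cond1 Y msc
  ... | inj₁ disjoint = inj₁ (λ (v∈X′ , v∈Y) → disjoint (X′⊆X v∈X′ , v∈Y))
  ... | inj₂ Y⊆X with DecMem._∈?_ FinP._≟_ e Y
  ...   | no e∉Y = inj₂ (λ v∈Y → X⊆e∷X′ (Y⊆X v∈Y) (λ { refl → e∉Y v∈Y }))
  ...   | yes e∈Y = inj₁ (λ (v∈X′ , v∈Y) → no-bridge Y msc e∈Y v∈Y v∈X′)

  SConnected-bridge : ∀ {X X′ e} → SConnected S t X → CadetSeq t X′ → X′ ⊆ X → e ∈ X → e ∉ X′ →
    (∀ {v} → v ∈ X → v ≢ e → v ∈ X′) →
    ¬ (∀ Y {v} → MaxSCadetSeq S t Y → e ∈ Y → v ∈ Y → v ∈ X′ → ⊥)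
  SConnected-bridge (_ , cond1 , minimal) csX′ X′⊆X e∈X e∉X′ X⊆e∷X′ no-bridge =
    minimal _ csX′ (Cond1-remove cond1 X′⊆X X⊆e∷X′ no-bridge) (X′⊆X , λ X⊆X′ → e∉X′ (X⊆X′ e∈X))

-- The first two maximal 𝐒-cadet sequences

module FirstTwo {n m : ℕ} (S : Deformation n) (t : Tree n m) (uq : Unique (labels t))
  (x₁ x₂ : Fin n) (L : List (Fin n)) (sconn : SConnected S t (x₁ ∷ x₂ ∷ L)) where

  open CadetChains t
  open SCadetSeqs S t
  open MaxSCadetSeqs S t uq

  X : List (Fin n)
  X = x₁ ∷ x₂ ∷ L

  cX : CadetChain X
  cX = CadetSeq⇒CadetChain X (proj₁ sconn)

  open MaxSCadetSeqsOf S t uq X cX (proj₁ (proj₂ sconn))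

  x₁∉ : x₁ ∉ x₂ ∷ L
  x₁∉ = Unique[x∷xs]⇒x∉xs X-unique

  head-block : ∀ {Y v} → MaxSCadetSeq S t Y → x₁ ∈ Y → v ∈ Y → v ∈ x₂ ∷ L →
    Σ[ Y₃ ∈ List (Fin n) ] Σ[ B ∈ List (Fin n) ] (Y ≡ x₁ ∷ x₂ ∷ Y₃ × L ≡ Y₃ ++ B)
  head-block {Y} msc x₁∈Y v∈Y v∈ with MaxSCadetSeqOf⇒segment Y (msc , MaxSCadetSeq-meets⇒⊆ Y msc x₁∈Y (here refl))
  ... | a ∷ A , B , eX with refl , eX′ ← ListP.∷-injective eX =
    ⊥-elim (x₁∉ (subst (x₁ ∈_) (sym eX′) (∈P.∈-++⁺ʳ A (∈P.∈-++⁺ˡ x₁∈Y))))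
  ... | [] , B , eX with Y | eX | v∈Y
  ...   | _ ∷ []      | eX′ | here refl with refl , _ ← ListP.∷-injective eX′ = ⊥-elim (x₁∉ v∈)
  ...   | _ ∷ _ ∷ Y₃ | eX′ | _ with refl , eX″ ← ListP.∷-injective eX′ with refl , eL ← ListP.∷-injective eX″ =
    Y₃ , B , refl , eL

  head-block-exists : ¬ (∀ Y₃ B → MaxSCadetSeq S t (x₁ ∷ x₂ ∷ Y₃) → L ≡ Y₃ ++ B → ⊥)
  head-block-exists no-block =
    SConnected-bridge S t sconn (CadetChain⇒CadetSeq (CadetChain-++⁻ʳ (x₁ ∷ []) cX)) there (here refl) x₁∉ tail-of
      (λ Y msc x₁∈Y v∈Y v∈ → let (Y₃ , B , eY , eL) = head-block msc x₁∈Y v∈Y v∈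
                             in no-block Y₃ B (subst (MaxSCadetSeq S t) eY msc) eL)
    where
    tail-of : ∀ {v} → v ∈ X → v ≢ x₁ → v ∈ x₂ ∷ L
    tail-of (here refl) v≢x₁ = ⊥-elim (v≢x₁ refl)
    tail-of (there v∈)  _    = v∈

  -- The 𝐒-cadet sequence x₂ ∷ b forces the maximal 𝐒-cadet sequence Y′ through x₂ to
  -- extend beyond Y, and no maximal 𝐒-cadet sequence of X ends in between.
  module Obstructed (Y₃ BY : List (Fin n)) (mY : MaxSCadetSeq S t (x₁ ∷ x₂ ∷ Y₃)) (eL : L ≡ Y₃ ++ BY)
    (b : List (Fin n)) (sb : SCadetSeq S t (x₂ ∷ b)) (¬sb : ¬ SCadetSeq S t (x₁ ∷ x₂ ∷ b)) where

    Y : List (Fin n)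
    Y = x₁ ∷ x₂ ∷ Y₃

    sY : SCadetSeq S t Y
    sY = MaxSCadetSeq⇒SCadetSeq mY

    next-in-b : Σ[ w ∈ Fin n ] SCadetSeq S t ((x₂ ∷ Y₃) ∷ʳ w)
    next-in-b with ∷-prefix-comparable Y₃ b (SCadetSeq⇒CadetChain (SCadetSeq-∷⁻ x₁ x₂ Y₃ sY)) (SCadetSeq⇒CadetChain sb)
    ... | inj₂ (R , eY₃) =
      ⊥-elim (¬sb (SCadetSeq-++⁻ˡ x₁ (x₂ ∷ b) {R} (subst (λ V → SCadetSeq S t (x₁ ∷ x₂ ∷ V)) eY₃ sY)))
    ... | inj₁ ([] , eb) =
      ⊥-elim (¬sb (subst (λ V → SCadetSeq S t (x₁ ∷ x₂ ∷ V)) (sym (trans eb (ListP.++-identityʳ Y₃))) sY))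
    ... | inj₁ (w ∷ R , eb) =
      w , SCadetSeq-++⁻ˡ x₂ (Y₃ ∷ʳ w) {R}
            (subst (λ V → SCadetSeq S t (x₂ ∷ V)) (trans eb (sym (ListP.++-assoc Y₃ (w ∷ []) R))) sb)

    w : Fin n
    w = proj₁ next-in-b

    preY postY : List (Fin n)
    preY = proj₁ mY
    postY = proj₁ (proj₂ mY)

    mcY : MaxCadetSeq t (preY ++ Y ++ postY)
    mcY = proj₁ (proj₂ (proj₂ mY))

    after-Y : Σ[ post′ ∈ List (Fin n) ] postY ≡ w ∷ post′
    after-Y = MaxCadetSeq-next preY Y postY mcY (s≤s z≤n)
      (CadetChain-head-step (SCadetSeq⇒CadetChain {Y} sY) ∷ SCadetSeq⇒CadetChain (proj₂ next-in-b))

    extension : Σ[ es ∈ List (Fin n) ] Σ[ post ∈ List (Fin n) ]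
      (proj₁ after-Y ≡ es ++ post × SCadetSeq S t (((x₂ ∷ Y₃) ∷ʳ w) ++ es) ×
       Blockedʳ (((x₂ ∷ Y₃) ∷ʳ w) ++ es) post)
    extension = SCadetSeq-extendʳ ((x₂ ∷ Y₃) ∷ʳ w) (proj₂ next-in-b) (proj₁ after-Y)

    e post″ : List (Fin n)
    e = proj₁ extension
    post″ = proj₁ (proj₂ extension)

    Y′ : List (Fin n)
    Y′ = ((x₂ ∷ Y₃) ∷ʳ w) ++ e

    preY++Y++postY : preY ++ Y ++ postY ≡ (preY ∷ʳ x₁) ++ Y′ ++ post″
    preY++Y++postY = begin
      preY ++ x₁ ∷ x₂ ∷ Y₃ ++ postY
        ≡⟨ cong (λ V → preY ++ x₁ ∷ x₂ ∷ Y₃ ++ V)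
                (trans (proj₂ after-Y) (cong (w ∷_) (proj₁ (proj₂ (proj₂ extension))))) ⟩
      preY ++ x₁ ∷ x₂ ∷ Y₃ ++ w ∷ e ++ post″
        ≡⟨ cong (λ V → preY ++ x₁ ∷ x₂ ∷ V) (sym (ListP.++-assoc Y₃ (w ∷ []) (e ++ post″))) ⟩
      preY ++ x₁ ∷ x₂ ∷ (Y₃ ∷ʳ w) ++ e ++ post″
        ≡⟨ cong (λ V → preY ++ x₁ ∷ x₂ ∷ V) (sym (ListP.++-assoc (Y₃ ∷ʳ w) e post″)) ⟩
      preY ++ x₁ ∷ Y′ ++ post″
        ≡⟨ sym (ListP.++-assoc preY (x₁ ∷ []) (Y′ ++ post″)) ⟩
      (preY ∷ʳ x₁) ++ Y′ ++ post″ ∎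
      where open ≡-Reasoning

    mY′ : MaxSCadetSeq S t Y′
    mY′ = preY ∷ʳ x₁ , post″ , subst (MaxCadetSeq t) preY++Y++postY mcY , proj₁ (proj₂ (proj₂ (proj₂ extension))) ,
          inj₂ (preY , x₁ , refl , λ s → MaxSCadetSeq-∷ʳ w mY (SCadetSeq-++⁻ˡ x₁ (x₂ ∷ (Y₃ ∷ʳ w)) {e} s)) ,
          proj₂ (proj₂ (proj₂ (proj₂ extension)))

    x₁∉Y′ : x₁ ∉ Y′
    x₁∉Y′ x₁∈Y′ = Unique-++⇒∉ (preY ∷ʳ x₁)
      (CadetChain⇒Unique uq (CadetSeq⇒CadetChain _ (proj₁ (subst (MaxCadetSeq t) preY++Y++postY mcY))))
      (∈P.∈-++⁺ʳ preY (here refl)) (∈P.∈-++⁺ˡ x₁∈Y′)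

    Y′⊆X : Y′ ⊆ X
    Y′⊆X = MaxSCadetSeq-meets⇒⊆ Y′ mY′ (here refl) (there (here refl))

    X≡Y++BY : X ≡ [] ++ Y ++ BY
    X≡Y++BY = cong (λ V → x₁ ∷ x₂ ∷ V) eL

    X≡x₁∷Y′++B′ : Σ[ B′ ∈ List (Fin n) ] X ≡ (x₁ ∷ []) ++ Y′ ++ B′
    X≡x₁∷Y′++B′ = from-segment (MaxSCadetSeqOf⇒segment Y′ (mY′ , Y′⊆X))
      where
      from-segment : Σ[ A ∈ List (Fin n) ] Σ[ B′ ∈ List (Fin n) ] X ≡ A ++ Y′ ++ B′ →
        Σ[ B′ ∈ List (Fin n) ] X ≡ (x₁ ∷ []) ++ Y′ ++ B′
      from-segment ([] , _ , eX) = ⊥-elim (x₁∉ (here (proj₁ (ListP.∷-injective eX))))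
      from-segment (_ ∷ [] , B′ , eX) =
        B′ , subst (λ a → X ≡ (a ∷ []) ++ Y′ ++ B′) (sym (proj₁ (ListP.∷-injective eX))) eX
      from-segment (_ ∷ _ ∷ A , _ , eX) = ⊥-elim (Unique[x∷xs]⇒x∉xs (Unique-++⁻ʳ (x₁ ∷ []) X-unique)
        (subst (x₂ ∈_) (sym (proj₂ (ListP.∷-injective (proj₂ (ListP.∷-injective eX))))) (∈P.∈-++⁺ʳ A (here refl))))

    B′ : List (Fin n)
    B′ = proj₁ X≡x₁∷Y′++B′

    MaxSCadetSeq-prefix⇒≡Y : ∀ {Z B} → MaxSCadetSeq S t Z → X ≡ Z ++ B → Z ≡ Y
    MaxSCadetSeq-prefix⇒≡Y {_ ∷ _} mZ eX with refl , _ ← ListP.∷-injective eX =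
      cong (x₁ ∷_) (MaxSCadetSeq-head-injective mZ mY)
    MaxSCadetSeq-prefix⇒≡Y {[]} (_ , _ , _ , () , _) _

    MaxSCadetSeq-not-inside-Y′ : ∀ A {Z B} → MaxSCadetSeq S t Z → A ++ Z ++ B ≡ Y′ ++ B′ →
      length A ℕ.+ length Z < length Y′ → ⊥
    MaxSCadetSeq-not-inside-Y′ A {Z} {B} mZ eq lt =
      let (d , ds , eY′) = ++-≡-++-< (A ++ Z) B Y′ B′ (trans (ListP.++-assoc A Z B) eq)
                                     (subst (_< length Y′) (sym (ListP.length-++ A)) lt)
      in MaxSCadetSeq-infix A d ds mZ (subst (SCadetSeq S t) (trans eY′ (ListP.++-assoc A Z (d ∷ ds))) (MaxSCadetSeq⇒SCadetSeq mY′))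

    Y-first : OnlyBelow (MaxSCadetSeqOf S t X) (LastBefore X) Y Y′
    Y-first = (mY , λ {v} v∈Y → subst (v ∈_) (sym X≡Y++BY) (∈P.∈-++⁺ˡ v∈Y)) , (mY′ , Y′⊆X) ,
      segments⇒LastBefore [] Y BY (x₁ ∷ []) Y′ B′ X≡Y++BY eXY′ (s≤s z≤n) (s≤s z≤n)
        (s≤s (s≤s (ℕP.≤-trans (ℕP.≤-reflexive (sym (length-∷ʳ Y₃ w))) (ListP.length-++-≤ˡ (Y₃ ∷ʳ w))))) ,
      only-Y
      where
      eXY′ : X ≡ (x₁ ∷ []) ++ Y′ ++ B′
      eXY′ = proj₂ X≡x₁∷Y′++B′
      only-Y : ∀ Z → MaxSCadetSeqOf S t X Z → LastBefore X Z Y′ → Z ≡ Y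
      only-Y Z mZ Z<Y′ = from-segment (MaxSCadetSeqOf⇒segment Z mZ)
        where
        from-segment : Σ[ A ∈ List (Fin n) ] Σ[ B ∈ List (Fin n) ] X ≡ A ++ Z ++ B → Z ≡ Y
        from-segment ([] , B , eXZ) = MaxSCadetSeq-prefix⇒≡Y (proj₁ mZ) eXZ
        from-segment (a ∷ A , B , eXZ) =
          ⊥-elim (MaxSCadetSeq-not-inside-Y′ A (proj₁ mZ) (proj₂ (ListP.∷-injective (trans (sym eXZ) eXY′)))
                    (ℕP.≤-pred (LastBefore⇒segments (a ∷ A) Z B (x₁ ∷ []) Y′ B′ eXZ eXY′ Z<Y′)))

    Y∖Y′ : length (Y ∖ Y′) ≡ 1
    Y∖Y′ = cong length
      (∖-singleton [] [] x₁∉Y′ (here refl ∷ All.tabulate (λ v∈Y₃ → there (∈P.∈-++⁺ˡ (∈P.∈-++⁺ˡ v∈Y₃)))))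

    first-two-differ-by-one : ∀ {X₁ X₂} → OnlyBelow (MaxSCadetSeqOf S t X) (LastBefore X) X₁ X₂ → length (X₁ ∖ X₂) ≡ 1
    first-two-differ-by-one X₁X₂ =
      let (Y≡X₁ , Y′≡X₂) = OnlyBelow-LastBefore-unique Y-first X₁X₂
      in subst₂ (λ a b → length (a ∖ b) ≡ 1) Y≡X₁ Y′≡X₂ Y∖Y′

  private
    module Count = SignedCount (isSCadet S t)

  unobstructed⇒rS≡0 : (∀ b → SCadetSeq S t (x₂ ∷ b) → SCadetSeq S t (x₁ ∷ x₂ ∷ b)) → rS S t X ≡ + 0
  unobstructed⇒rS≡0 merge =
    Count.signedCount≡0 X (Head.sum-weight-head L (Unique[x∷xs]⇒x∉xs (Unique-++⁻ʳ (x₁ ∷ []) X-unique)))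
    where
    cadet-x₁ : ∀ {h b} → SCadetSeq S t (x₁ ∷ h ∷ b) → h ≡ x₂
    cadet-x₁ {h} {b} s = MaybeP.just-injective (trans (sym (CadetChain-head-step (SCadetSeq⇒CadetChain {x₁ ∷ h ∷ b} s)))
                                                      (CadetChain-head-step cX))
    module Head = Count.HeadCancellation x₁ x₂
      (λ b → Count.blockWeight-cong (x₁ ∷ x₂ ∷ b) (x₂ ∷ b) (SCadetSeq-∷⁻ x₁ x₂ b) (merge b))
      (λ h b h≢x₂ → Count.blockWeight-zero (x₁ ∷ h ∷ b) (h≢x₂ ∘ cadet-x₁ {h} {b}))
      refl

  first-two-differ-by-one : rS S t X ≢ + 0 →
    ∀ {X₁ X₂} → OnlyBelow (MaxSCadetSeqOf S t X) (LastBefore X) X₁ X₂ → length (X₁ ∖ X₂) ≡ 1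
  first-two-differ-by-one rS≢0 {X₁} {X₂} X₁X₂ with length (X₁ ∖ X₂) ℕ.≟ 1
  ... | yes eq = eq
  ... | no neq = ⊥-elim (rS≢0 (unobstructed⇒rS≡0 merge))
    where
    merge : ∀ b → SCadetSeq S t (x₂ ∷ b) → SCadetSeq S t (x₁ ∷ x₂ ∷ b)
    merge b sb with T? (isSCadet S t (x₁ ∷ x₂ ∷ b))
    ... | yes s = s
    ... | no ¬s = ⊥-elim (head-block-exists λ Y₃ BY mY eL →
                    neq (Obstructed.first-two-differ-by-one Y₃ BY mY eL b sb ¬s X₁X₂))

-- The last two maximal 𝐒-cadet sequences

module LastTwo {n m : ℕ} (S : Deformation n) (t : Tree n m) (uq : Unique (labels t))
  (pre : List (Fin n)) (y z : Fin n) (sconn : SConnected S t (pre ++ y ∷ z ∷ [])) where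

  open CadetChains t
  open SCadetSeqs S t
  open MaxSCadetSeqs S t uq

  X : List (Fin n)
  X = pre ++ y ∷ z ∷ []

  X≡pre∷ʳy∷ʳz : X ≡ (pre ∷ʳ y) ∷ʳ z
  X≡pre∷ʳy∷ʳz = sym (ListP.++-assoc pre (y ∷ []) (z ∷ []))

  cX : CadetChain X
  cX = CadetSeq⇒CadetChain X (proj₁ sconn)

  open MaxSCadetSeqsOf S t uq X cX (proj₁ (proj₂ sconn))

  z∉ : z ∉ pre ∷ʳ y
  z∉ z∈ = Unique-++⇒∉ (pre ∷ʳ y) (subst Unique X≡pre∷ʳy∷ʳz X-unique) z∈ (here refl)

  z∈X : z ∈ X
  z∈X = ∈P.∈-++⁺ʳ pre (there (here refl))

  tail-block : ∀ {Y v} → MaxSCadetSeq S t Y → z ∈ Y → v ∈ Y → v ∈ pre ∷ʳ y →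
    Σ[ Y₃ ∈ List (Fin n) ] Σ[ A ∈ List (Fin n) ] (Y ≡ Y₃ ++ y ∷ z ∷ [] × pre ≡ A ++ Y₃)
  tail-block {Y} msc z∈Y v∈Y v∈ with MaxSCadetSeqOf⇒segment Y (msc , MaxSCadetSeq-meets⇒⊆ Y msc z∈Y z∈X)
  ... | A , b ∷ B , eX =
    ⊥-elim (Unique-++⇒∉ (A ++ Y) (subst Unique eX′ X-unique) (∈P.∈-++⁺ʳ A z∈Y) (last-∈ (b ∷ B) last-B))
    where
    eX′ : X ≡ (A ++ Y) ++ b ∷ B
    eX′ = trans eX (sym (ListP.++-assoc A Y (b ∷ B)))
    last-B : last (b ∷ B) ≡ just z
    last-B = trans (sym (last-++-∷ (A ++ Y) b B)) (trans (cong last (sym eX′)) (last-++-∷ pre y (z ∷ [])))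
  ... | A , [] , eX with MaxSCadetSeq⇒∷ʳ msc
  ...   | Y₀ , z′ , refl
    with e₁ , refl ← ListP.∷ʳ-injective (pre ∷ʳ y) (A ++ Y₀)
                       (trans (sym X≡pre∷ʳy∷ʳz) (trans eX (++-∷ʳ-++ A Y₀ z′ [])))
    with List.initLast Y₀ | v∈Y
  ...     | [] | here refl = ⊥-elim (z∉ v∈)
  ...     | Y₃ List.∷ʳ′ y′ | _
    with e₂ , refl ← ListP.∷ʳ-injective pre (A ++ Y₃) (trans e₁ (sym (ListP.++-assoc A Y₃ (y′ ∷ [])))) =
    Y₃ , A , ListP.++-assoc Y₃ (y ∷ []) (z ∷ []) , e₂

  tail-block-exists : ¬ (∀ Y₃ A → MaxSCadetSeq S t (Y₃ ++ y ∷ z ∷ []) → pre ≡ A ++ Y₃ → ⊥)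
  tail-block-exists no-block =
    SConnected-bridge S t sconn
      (CadetChain⇒CadetSeq-∷ʳ pre (CadetChain-++⁻ˡ (pre ∷ʳ y) (subst CadetChain X≡pre∷ʳy∷ʳz cX)))
      init⊆X z∈X z∉ init-of
      (λ Y msc z∈Y v∈Y v∈ → let (Y₃ , A , eY , ePre) = tail-block msc z∈Y v∈Y v∈
                            in no-block Y₃ A (subst (MaxSCadetSeq S t) eY msc) ePre)
    where
    init⊆X : pre ∷ʳ y ⊆ X
    init⊆X v∈ = subst (_ ∈_) (sym X≡pre∷ʳy∷ʳz) (∈P.∈-++⁺ˡ v∈)
    init-of : ∀ {v} → v ∈ X → v ≢ z → v ∈ pre ∷ʳ y
    init-of {v} v∈X v≢z with ∈P.∈-++⁻ (pre ∷ʳ y) (subst (v ∈_) X≡pre∷ʳy∷ʳz v∈X)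
    ... | inj₁ v∈       = v∈
    ... | inj₂ (here refl) = ⊥-elim (v≢z refl)

  module Obstructed (Y₃ A : List (Fin n)) (mY : MaxSCadetSeq S t (Y₃ ++ y ∷ z ∷ [])) (ePre : pre ≡ A ++ Y₃)
    (u : List (Fin n)) (su : SCadetSeq S t (u ∷ʳ y)) (¬su : ¬ SCadetSeq S t ((u ∷ʳ y) ∷ʳ z)) where

    Y : List (Fin n)
    Y = Y₃ ++ y ∷ z ∷ []

    Y≡Y₃∷ʳy∷ʳz : Y ≡ (Y₃ ∷ʳ y) ∷ʳ z
    Y≡Y₃∷ʳy∷ʳz = sym (ListP.++-assoc Y₃ (y ∷ []) (z ∷ []))

    sY : SCadetSeq S t Y
    sY = MaxSCadetSeq⇒SCadetSeq mY

    u-not-suffix : ∀ R → Y₃ ≡ R ++ u → ⊥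
    u-not-suffix R eY₃ = ¬su (SCadetSeq-++-∷ʳ⁻ʳ R (u ∷ʳ y) z (subst (SCadetSeq S t) eY sY))
      where
      eY : Y ≡ R ++ (u ∷ʳ y) ∷ʳ z
      eY = begin
        Y₃ ++ y ∷ z ∷ []          ≡⟨ cong (_++ y ∷ z ∷ []) eY₃ ⟩
        (R ++ u) ++ y ∷ z ∷ []    ≡⟨ ListP.++-assoc R u (y ∷ z ∷ []) ⟩
        R ++ u ++ y ∷ z ∷ []      ≡⟨ cong (R ++_) (sym (ListP.++-assoc u (y ∷ []) (z ∷ []))) ⟩
        R ++ (u ∷ʳ y) ∷ʳ z        ∎
        where open ≡-Reasoning

    previous-in-u : Σ[ w ∈ Fin n ] SCadetSeq S t (w ∷ (Y₃ ∷ʳ y))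
    previous-in-u with ∷ʳ-suffix-comparable uq u Y₃ (SCadetSeq⇒CadetChain su)
                         (CadetChain-++⁻ˡ (Y₃ ∷ʳ y) (subst CadetChain Y≡Y₃∷ʳy∷ʳz (SCadetSeq⇒CadetChain sY)))
    ... | inj₁ (R , eY₃) = ⊥-elim (u-not-suffix R eY₃)
    ... | inj₂ (R , eu) with List.initLast R
    ...   | [] = ⊥-elim (u-not-suffix [] (sym eu))
    ...   | R′ List.∷ʳ′ w = w , SCadetSeq-++⁻ʳ R′ w (Y₃ ∷ʳ y) (subst (SCadetSeq S t) eq su)
      where
      eq : u ∷ʳ y ≡ R′ ++ w ∷ (Y₃ ∷ʳ y)
      eq = trans (cong (_∷ʳ y) eu)
                 (trans (ListP.++-assoc (R′ ∷ʳ w) Y₃ (y ∷ [])) (ListP.++-assoc R′ (w ∷ []) (Y₃ ∷ʳ y)))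

    w : Fin n
    w = proj₁ previous-in-u

    preY postY : List (Fin n)
    preY = proj₁ mY
    postY = proj₁ (proj₂ mY)

    mcY : MaxCadetSeq t (preY ++ Y ++ postY)
    mcY = proj₁ (proj₂ (proj₂ mY))

    Y++postY : Y ++ postY ≡ (Y₃ ∷ʳ y) ++ z ∷ postY
    Y++postY = trans (ListP.++-assoc Y₃ (y ∷ z ∷ []) postY) (sym (ListP.++-assoc Y₃ (y ∷ []) (z ∷ postY)))

    before-Y : Σ[ pre′ ∈ List (Fin n) ] preY ≡ pre′ ∷ʳ w
    before-Y = MaxCadetSeq-previous preY (Y₃ ∷ʳ y) (z ∷ postY) (subst (MaxCadetSeq t) (cong (preY ++_) Y++postY) mcY)
      (subst (0 <_) (sym (length-∷ʳ Y₃ y)) (s≤s z≤n)) (SCadetSeq⇒CadetChain (proj₂ previous-in-u))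

    extension : Σ[ es ∈ List (Fin n) ] Σ[ pre ∈ List (Fin n) ]
      (proj₁ before-Y ≡ pre ++ es × SCadetSeq S t (es ++ w ∷ (Y₃ ∷ʳ y)) × Blockedˡ pre (es ++ w ∷ (Y₃ ∷ʳ y)))
    extension = SCadetSeq-extendˡ (w ∷ (Y₃ ∷ʳ y)) (proj₂ previous-in-u) (proj₁ before-Y)

    e pre″ : List (Fin n)
    e = proj₁ extension
    pre″ = proj₁ (proj₂ extension)

    Y′ : List (Fin n)
    Y′ = e ++ w ∷ (Y₃ ∷ʳ y)

    preY++Y++postY : preY ++ Y ++ postY ≡ pre″ ++ Y′ ++ z ∷ postY
    preY++Y++postY = begin
      preY ++ Y ++ postY
        ≡⟨ cong₂ _++_ (proj₂ before-Y) Y++postY ⟩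
      (proj₁ before-Y ∷ʳ w) ++ (Y₃ ∷ʳ y) ++ z ∷ postY
        ≡⟨ cong (λ V → (V ∷ʳ w) ++ (Y₃ ∷ʳ y) ++ z ∷ postY) (proj₁ (proj₂ (proj₂ extension))) ⟩
      ((pre″ ++ e) ∷ʳ w) ++ (Y₃ ∷ʳ y) ++ z ∷ postY
        ≡⟨ ListP.++-assoc (pre″ ++ e) (w ∷ []) _ ⟩
      (pre″ ++ e) ++ w ∷ (Y₃ ∷ʳ y) ++ z ∷ postY
        ≡⟨ ListP.++-assoc pre″ e _ ⟩
      pre″ ++ e ++ w ∷ (Y₃ ∷ʳ y) ++ z ∷ postY
        ≡⟨ cong (pre″ ++_) (sym (ListP.++-assoc e (w ∷ (Y₃ ∷ʳ y)) (z ∷ postY))) ⟩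
      pre″ ++ Y′ ++ z ∷ postY ∎
      where open ≡-Reasoning

    mY′ : MaxSCadetSeq S t Y′
    mY′ = pre″ , z ∷ postY , subst (MaxCadetSeq t) preY++Y++postY mcY , proj₁ (proj₂ (proj₂ (proj₂ extension))) ,
          proj₂ (proj₂ (proj₂ (proj₂ extension))) , inj₂ (z , postY , refl , ¬Y′∷ʳz)
      where
      eq : Y′ ∷ʳ z ≡ e ++ w ∷ Y
      eq = trans (ListP.++-assoc e (w ∷ (Y₃ ∷ʳ y)) (z ∷ [])) (cong (λ V → e ++ w ∷ V) (sym Y≡Y₃∷ʳy∷ʳz))
      ¬Y′∷ʳz : ¬ SCadetSeq S t (Y′ ∷ʳ z)
      ¬Y′∷ʳz s = MaxSCadetSeq-∷ w mY (SCadetSeq-++⁻ʳ e w Y (subst (SCadetSeq S t) eq s))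

    z∉Y′ : z ∉ Y′
    z∉Y′ z∈Y′ = Unique-++⇒∉ Y′
      (Unique-++⁻ʳ pre″ (CadetChain⇒Unique uq (CadetSeq⇒CadetChain _ (proj₁ (subst (MaxCadetSeq t) preY++Y++postY mcY)))))
      z∈Y′ (here refl)

    last-Y′ : last Y′ ≡ just y
    last-Y′ = trans (last-++-∷ e w (Y₃ ∷ʳ y)) (last-∷ʳ (w ∷ Y₃) y)

    last-Y : last Y ≡ just z
    last-Y = last-++-∷ Y₃ y (z ∷ [])

    Y-last : OnlyBelow (MaxSCadetSeqOf S t X) (flip (LastBefore X)) Y Y′
    Y-last = (mY , Y⊆X) , (mY′ , Y′⊆X) , Y′<Y , only-Y
      where
      Y⊆X : Y ⊆ X
      Y⊆X {v} v∈Y =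
        subst (v ∈_) (trans (sym (ListP.++-assoc A Y₃ (y ∷ z ∷ []))) (cong (_++ y ∷ z ∷ []) (sym ePre)))
              (∈P.∈-++⁺ʳ A v∈Y)
      Y′⊆X : Y′ ⊆ X
      Y′⊆X = MaxSCadetSeq-meets⇒⊆ Y′ mY′ (last-∈ Y′ last-Y′) (∈P.∈-++⁺ʳ pre (here refl))
      iy : Σ[ i ∈ Fin (length X) ] (lookup X i ≡ y × toℕ i ≡ length pre)
      iy = index-of pre y (z ∷ []) refl
      iz : Σ[ i ∈ Fin (length X) ] (lookup X i ≡ z × toℕ i ≡ length (pre ∷ʳ y))
      iz = index-of (pre ∷ʳ y) z [] X≡pre∷ʳy∷ʳz
      toℕ-iz : toℕ (proj₁ iz) ≡ suc (length pre)
      toℕ-iz = trans (proj₂ (proj₂ iz)) (length-∷ʳ pre y)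
      last-Y′-at : last Y′ ≡ just (lookup X (proj₁ iy))
      last-Y′-at = trans last-Y′ (cong just (sym (proj₁ (proj₂ iy))))
      last-Y-at : last Y ≡ just (lookup X (proj₁ iz))
      last-Y-at = trans last-Y (cong just (sym (proj₁ (proj₂ iz))))
      Y′<Y : LastBefore X Y′ Y
      Y′<Y = proj₁ iy , proj₁ iz , subst₂ _<_ (sym (proj₂ (proj₂ iy))) (sym toℕ-iz) ℕP.≤-refl , last-Y′-at , last-Y-at
      only-Y : ∀ Z → MaxSCadetSeqOf S t X Z → LastBefore X Y′ Z → Z ≡ Y
      only-Y Z mZ (i , j , i<j , ei , ej) =
        MaxSCadetSeq-last-injective (proj₁ mZ) mY (trans ej (trans (cong (just ∘ lookup X) j≡iz) (sym last-Y-at)))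
        where
        toℕ-i : toℕ i ≡ length pre
        toℕ-i = trans (cong toℕ (Unique⇒lookup-injective X-unique (MaybeP.just-injective (trans (sym ei) last-Y′-at))))
                      (proj₂ (proj₂ iy))
        j<2+pre : toℕ j < suc (suc (length pre))
        j<2+pre = subst (toℕ j <_) (trans (ListP.length-++ pre) (ℕP.+-comm (length pre) 2)) (FinP.toℕ<n j)
        j≡iz : j ≡ proj₁ iz
        j≡iz = FinP.toℕ-injective (trans (ℕP.≤-antisym (ℕP.≤-pred j<2+pre) (subst (_< toℕ j) toℕ-i i<j)) (sym toℕ-iz))

    Y∖Y′ : length (Y ∖ Y′) ≡ 1
    Y∖Y′ = cong length (trans (cong (_∖ Y′) Y≡Y₃∷ʳy∷ʳz)
      (∖-singleton (Y₃ ∷ʳ y) (All.tabulate (λ v∈ → ∈P.∈-++⁺ʳ e (there v∈))) z∉Y′ []))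

    last-two-differ-by-one : ∀ {Xk Xk-1} → OnlyBelow (MaxSCadetSeqOf S t X) (flip (LastBefore X)) Xk Xk-1 →
      length (Xk ∖ Xk-1) ≡ 1
    last-two-differ-by-one XkXk-1 =
      let (Y≡Xk , Y′≡Xk-1) = OnlyAbove-LastBefore-unique Y-last XkXk-1
      in subst₂ (λ a b → length (a ∖ b) ≡ 1) Y≡Xk Y′≡Xk-1 Y∖Y′

  private
    module Count = SignedCount (isSCadet S t)

  unobstructed⇒rS≡0 : (∀ u → SCadetSeq S t (u ∷ʳ y) → SCadetSeq S t ((u ∷ʳ y) ∷ʳ z)) → rS S t X ≡ + 0
  unobstructed⇒rS≡0 merge = Count.signedCount≡0 X (Tail.sum-weight-tail pre not-before-z refl
    (λ u → Count.blockWeight-cong ((u ∷ʳ y) ∷ʳ z) (u ∷ʳ y) (SCadetSeq-∷ʳ⁻ u y z) (merge u)))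
    where
    module Tail = Count.TailCancellation y z
      (λ a h r zero → Count.blockWeight-zero (a ∷ h ∷ r) (Count.blockWeight≡0⇒¬ (h ∷ r) zero ∘ SCadetSeq-∷⁻ a h r))
    y∉pre : y ∉ pre
    y∉pre y∈ = Unique-++⇒∉ pre X-unique y∈ (here refl)
    not-before-z : All (λ a → Count.blockWeight (a ∷ z ∷ []) ≡ + 0) pre
    not-before-z = All.tabulate λ {a} a∈pre → Count.blockWeight-zero (a ∷ z ∷ []) λ s →
      y∉pre (subst (_∈ pre) (cadet-injective t uq (CadetChain-head-step (SCadetSeq⇒CadetChain {a ∷ z ∷ []} s))
                                                  (CadetChain-step pre cX)) a∈pre)

  last-two-differ-by-one : rS S t X ≢ + 0 →
    ∀ {Xk Xk-1} → OnlyBelow (MaxSCadetSeqOf S t X) (flip (LastBefore X)) Xk Xk-1 → length (Xk ∖ Xk-1) ≡ 1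
  last-two-differ-by-one rS≢0 {Xk} {Xk-1} XkXk-1 with length (Xk ∖ Xk-1) ℕ.≟ 1
  ... | yes eq = eq
  ... | no neq = ⊥-elim (rS≢0 (unobstructed⇒rS≡0 merge))
    where
    merge : ∀ u → SCadetSeq S t (u ∷ʳ y) → SCadetSeq S t ((u ∷ʳ y) ∷ʳ z)
    merge u su with T? (isSCadet S t ((u ∷ʳ y) ∷ʳ z))
    ... | yes s = s
    ... | no ¬s = ⊥-elim (tail-block-exists λ Y₃ A mY ePre →
                    neq (Obstructed.last-two-differ-by-one Y₃ A mY ePre u su ¬s XkXk-1))

LastBefore-singleton : ∀ {n} (x : Fin n) Z W → ¬ LastBefore (x ∷ []) Z W
LastBefore-singleton x Z W (Fin.zero , Fin.zero , () , _)

first-two-differ-by-one : ∀ {n m} (S : Deformation n) (t : Tree n m) → Unique (labels t) →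
  ∀ X → SConnected S t X → rS S t X ≢ + 0 →
  ∀ {X₁ X₂} → OnlyBelow (MaxSCadetSeqOf S t X) (LastBefore X) X₁ X₂ → length (X₁ ∖ X₂) ≡ 1
first-two-differ-by-one S t uq (x₁ ∷ x₂ ∷ L) sconn = FirstTwo.first-two-differ-by-one S t uq x₁ x₂ L sconn
first-two-differ-by-one S t uq (x ∷ [])      _     _ {X₁} {X₂} (_ , _ , lb , _) = ⊥-elim (LastBefore-singleton x X₁ X₂ lb)
first-two-differ-by-one S t uq []            (() , _)

last-two-differ-by-one : ∀ {n m} (S : Deformation n) (t : Tree n m) → Unique (labels t) →
  ∀ X → SConnected S t X → rS S t X ≢ + 0 →
  ∀ {Xk Xk-1} → OnlyBelow (MaxSCadetSeqOf S t X) (flip (LastBefore X)) Xk Xk-1 → length (Xk ∖ Xk-1) ≡ 1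
last-two-differ-by-one {n} S t uq X = by-view (reverseView X)
  where
  Claim : List (Fin n) → Set
  Claim V = SConnected S t V → rS S t V ≢ + 0 →
    ∀ {Xk Xk-1} → OnlyBelow (MaxSCadetSeqOf S t V) (flip (LastBefore V)) Xk Xk-1 → length (Xk ∖ Xk-1) ≡ 1
  by-view : ∀ {X} → Reverse X → Claim X
  by-view []                                      (() , _)
  by-view (_ ∶ [] ∶ʳ x) _ _ {Xk} {Xk-1} (_ , _ , lb , _) = ⊥-elim (LastBefore-singleton x Xk-1 Xk lb)
  by-view (_ ∶ (pre ∶ _ ∶ʳ y) ∶ʳ z) =
    subst Claim (sym (ListP.++-assoc pre (y ∷ []) (z ∷ []))) (λ sconn → LastTwo.last-two-differ-by-one S t uq pre y z sconn)

corollary3p21 : ∀ {n : ℕ} (S : Deformation n) (t : Tree n (mOf S)) → Labelled t →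
  (X : List (Fin n)) → SConnected S t X → rS S t X ≢ + 0 →
  -- X₁, X₂ : the first two maximal 𝐒-cadet sequences of X (so k' > 1)
  (∀ X₁ X₂ → MaxSCadetSeqOf S t X X₁ → MaxSCadetSeqOf S t X X₂ →
     LastBefore X X₁ X₂ →
     (∀ Z → MaxSCadetSeqOf S t X Z → LastBefore X Z X₂ → Z ≡ X₁) →
     length (X₁ ∖ X₂) ≡ 1)
  ×
  -- X_{k'-1}, X_{k'} : the last two maximal 𝐒-cadet sequences of X
  (∀ Xk' Xk'-1 → MaxSCadetSeqOf S t X Xk' → MaxSCadetSeqOf S t X Xk'-1 →
     LastBefore X Xk'-1 Xk' →
     (∀ Z → MaxSCadetSeqOf S t X Z → LastBefore X Xk'-1 Z → Z ≡ Xk') →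
     length (Xk' ∖ Xk'-1) ≡ 1)
corollary3p21 S t (uq , _) X sconn rS≢0 =
  (λ X₁ X₂ m₁ m₂ lb only → first-two-differ-by-one S t uq X sconn rS≢0 (m₁ , m₂ , lb , only)) ,
  (λ Xk Xk-1 mk mk-1 lb only → last-two-differ-by-one S t uq X sconn rS≢0 (mk , mk-1 , lb , only))
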